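{- For every $n\ge1$, the number $d_n$ of permutations in $\mathfrak S_n$ that avoid both $2\text{ - }1\text{ - }3$ and $\overline{2}^o\text{ - }31$ is $$d_n=\begin{cases}\frac{1}{2k+1}\binom{3k}{k} & \text{if } n=2k,\\[2pt] \frac{1}{2k+1}\binom{3k+1}{k+1} & \text{if } n=2k+1.\end{cases}$$
   Context: $\mathfrak S_n$ is the set of permutations $\pi=\pi_1\cdots\pi_n$ of $\{1,\dots,n\}$. A permutation $\pi$ avoids $2\text{ - }1\text{ - }3$ if there are no indices $i<j<k$ with $\pi_j<\pi_i<\pi_k$. A permutation $\pi$ avoids $\overline{2}^o\text{ - }31$ if for every index $i$ with $\pi_i>\pi_{i+1}$, the number of indices $j<i$ with $\pi_i>\pi_j>\pi_{i+1}$ is odd. -}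

module Defs where

open import Data.Nat using (ℕ; zero; suc; _+_; _*_; _/_; _%_)
open import Data.Nat.Combinatorics using (_C_)
import Data.Nat.Properties as ℕP
open import Data.Fin using (Fin; toℕ) renaming (_<_ to _<ᶠ_)
open import Data.Fin.Properties using (all?) renaming (_≟_ to _≟ᶠ_; _<?_ to _<ᶠ?_)
open import Data.Vec using (Vec; lookup; []; _∷_)
open import Data.Product using (_×_)
open import Data.List using (List; length; filter; allFin; concatMap) renaming ([] to nil; _∷_ to _::_; map to lmap)
open import Relation.Nullary using (¬_; Dec)
open import Relation.Nullary.Decidable using (_×-dec_; _→-dec_; ¬?)
open import Relation.Binary.PropositionalEquality using (_≡_)

-- A permutation π = π_1⋯π_n of {1,…,n} is represented (0-based) as a word
-- π : Vec (Fin n) n that is injective (hence a bijection of Fin n).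
IsPerm : ∀ {n} → Vec (Fin n) n → Set
IsPerm {n} π = ∀ (i j : Fin n) → lookup π i ≡ lookup π j → i ≡ j

Avoids213 : ∀ {n} → Vec (Fin n) n → Set
Avoids213 {n} π = ∀ (i j k : Fin n) → i <ᶠ j → j <ᶠ k →
  ¬ (lookup π j <ᶠ lookup π i × lookup π i <ᶠ lookup π k)

Odd : ℕ → Set
Odd m = m % 2 ≡ 1

between : ∀ {n} → Vec (Fin n) n → Fin n → Fin n → List (Fin n)
between π i i' =
  filter (λ j → j <ᶠ? i)
    (filter (λ j → lookup π i' <ᶠ? lookup π j)
      (filter (λ j → lookup π j <ᶠ? lookup π i) (allFin _)))

-- π avoids 2̄^o-31: for every index i with π_i > π_{i+1}, the number of
-- indices j < i with π_i > π_j > π_{i+1} is odd.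
AvoidsBar2o31 : ∀ {n} → Vec (Fin n) n → Set
AvoidsBar2o31 {n} π = ∀ (i i' : Fin n) → suc (toℕ i) ≡ toℕ i' →
  lookup π i' <ᶠ lookup π i → Odd (length (between π i i'))

Good : ∀ {n} → Vec (Fin n) n → Set
Good π = IsPerm π × Avoids213 π × AvoidsBar2o31 π

good? : ∀ {n} (π : Vec (Fin n) n) → Dec (Good π)
good? π =
  (all? λ i → all? λ j → (lookup π i ≟ᶠ lookup π j) →-dec (i ≟ᶠ j))
  ×-dec
  (all? λ i → all? λ j → all? λ k → (i <ᶠ? j) →-dec (j <ᶠ? k) →-dec
     ¬? ((lookup π j <ᶠ? lookup π i) ×-dec (lookup π i <ᶠ? lookup π k)))
  ×-dec
  (all? λ i → all? λ i' → (suc (toℕ i) ℕP.≟ toℕ i') →-dec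
     (lookup π i' <ᶠ? lookup π i) →-dec
     (length (between π i i') % 2 ℕP.≟ 1))

words : ∀ n m → List (Vec (Fin n) m)
words n zero = [] :: nil
words n (suc m) = concatMap (λ a → lmap (a ∷_) (words n m)) (allFin n)

d : ℕ → ℕ
d n = length (filter good? (words n n))

module Submission where

-- A 213-avoiding permutation with first entry m is m (β + m + 1) γ, where γ is a
-- permutation of {0, …, m-1} and β one of the remaining values, lowered ("gluing").  The
-- barred condition splits into the conditions on β and γ plus one condition at the
-- junction of the two blocks, which by a parity invariant (the last entry L of a good
-- permutation of [n] has L + 1 ≡ n mod 2) only says: γ is empty or |β| is odd.  Hence
--   d 0 = 1,   d (n+1) = Σ_{b+c=n, (b,c) admissible} d b · d c.
-- Splitting this recurrence by parity shows d (2k) = [x^k] T and d (2k+1) = [x^k] T²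
-- for the ternary-tree series T = 1 + x T³, whose coefficients are the binomial
-- quotients above.

open import Defs
open import Data.Nat using (ℕ; suc; _+_; _*_; _/_; _≥_)
open import Data.Nat.Combinatorics using (_C_)
open import Data.List using (length)
open import Data.Product using (_×_; _,_)
open import Relation.Binary.PropositionalEquality using (_≡_; refl; sym; trans; cong; cong₂; module ≡-Reasoning)


-- Coefficients of the ternary-tree series T = 1 + x T^3 and their binomial closed forms.
module Series where

  open import Data.Nat using (ℕ; zero; suc; _+_; _*_; _/_; z≤n; s≤s)
  open import Data.Nat.Properties
    using (+-identityʳ; +-assoc; +-comm; *-identityˡ; *-identityʳ; *-distribʳ-+; *-distribˡ-+; *-comm; *-zeroʳ;
           +-cancelʳ-≡; *-cancelˡ-≡)
  open import Data.Nat.Combinatorics using (_C_; nCk+nC[k+1]≡[n+1]C[k+1]; k>n⇒nCk≡0; nC1≡n)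
  open import Data.Nat.DivMod using (m*n/n≡m)
  open import Data.Nat.Tactic.RingSolver using (solve-∀)
  open import Relation.Binary.PropositionalEquality using (_≡_; refl; sym; trans; cong; cong₂; subst; module ≡-Reasoning)
  open ≡-Reasoning

  -- convolve h n = Σ_{b + c = n} h b c : the n-th coefficient of a product of two series.
  convolve : (ℕ → ℕ → ℕ) → ℕ → ℕ
  convolve h zero    = h 0 0
  convolve h (suc n) = h 0 (suc n) + convolve (λ b c → h (suc b) c) n

  convolve-cong : ∀ (h h′ : ℕ → ℕ → ℕ) n → (∀ b c → b + c ≡ n → h b c ≡ h′ b c) →
                  convolve h n ≡ convolve h′ n
  convolve-cong h h′ zero    e = e 0 0 refl
  convolve-cong h h′ (suc n) e =
    cong₂ _+_ (e 0 (suc n) refl)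
              (convolve-cong (λ b c → h (suc b) c) (λ b c → h′ (suc b) c) n
                             (λ b c b+c≡n → e (suc b) c (cong suc b+c≡n)))

  convolve-+ : ∀ (h h′ : ℕ → ℕ → ℕ) n →
               convolve (λ b c → h b c + h′ b c) n ≡ convolve h n + convolve h′ n
  convolve-+ h h′ zero    = refl
  convolve-+ h h′ (suc n) = begin
    (h 0 (suc n) + h′ 0 (suc n)) + convolve (λ b c → h (suc b) c + h′ (suc b) c) n
      ≡⟨ cong ((h 0 (suc n) + h′ 0 (suc n)) +_) (convolve-+ (λ b c → h (suc b) c) (λ b c → h′ (suc b) c) n) ⟩
    (h 0 (suc n) + h′ 0 (suc n)) + (convolve (λ b c → h (suc b) c) n + convolve (λ b c → h′ (suc b) c) n)
      ≡⟨ interchange (h 0 (suc n)) (h′ 0 (suc n)) _ _ ⟩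
    (h 0 (suc n) + convolve (λ b c → h (suc b) c) n) + (h′ 0 (suc n) + convolve (λ b c → h′ (suc b) c) n)
      ∎
    where interchange : ∀ a b c d → (a + b) + (c + d) ≡ (a + c) + (b + d)
          interchange = solve-∀

  convolve-zero : ∀ n → convolve (λ _ _ → 0) n ≡ 0
  convolve-zero zero    = refl
  convolve-zero (suc n) = convolve-zero n

  -- T k s = [x^k] T(x)^s, where T(x) = 1 + x T(x)^3 is the generating function of
  -- ternary trees; the recursion is the coefficient form of T^(s+1) = T^s + x T^(s+3).
  T : ℕ → ℕ → ℕ
  T zero    s       = 1
  T (suc k) zero    = 0
  T (suc k) (suc s) = T (suc k) s + T k (3 + s)

  T-convolution : ∀ k a b → convolve (λ i j → T i a * T j b) k ≡ T k (a + b)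
  T-convolution zero    zero    b = +-identityʳ 1
  T-convolution zero    (suc a) b = +-identityʳ 1
  T-convolution (suc k) zero    b = begin
    1 * T (suc k) b + convolve (λ _ _ → 0) k  ≡⟨ cong₂ _+_ (*-identityˡ (T (suc k) b)) (convolve-zero k) ⟩
    T (suc k) b + 0                           ≡⟨ +-identityʳ _ ⟩
    T (suc k) b                               ∎
  T-convolution (suc k) (suc a) b = begin
    1 * T (suc k) b + convolve (λ i j → T (suc i) (suc a) * T j b) k
      ≡⟨ cong (1 * T (suc k) b +_) (convolve-cong _ (λ i j → T (suc i) a * T j b + T i (3 + a) * T j b) k
                       (λ i j _ → *-distribʳ-+ (T j b) (T (suc i) a) (T i (3 + a)))) ⟩
    1 * T (suc k) b + convolve (λ i j → T (suc i) a * T j b + T i (3 + a) * T j b) k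
      ≡⟨ cong (1 * T (suc k) b +_) (convolve-+ (λ i j → T (suc i) a * T j b) (λ i j → T i (3 + a) * T j b) k) ⟩
    1 * T (suc k) b + (convolve (λ i j → T (suc i) a * T j b) k + convolve (λ i j → T i (3 + a) * T j b) k)
      ≡⟨ sym (+-assoc (1 * T (suc k) b) _ _) ⟩
    convolve (λ i j → T i a * T j b) (suc k) + convolve (λ i j → T i (3 + a) * T j b) k
      ≡⟨ cong₂ _+_ (T-convolution (suc k) a b) (T-convolution k (3 + a) b) ⟩
    T (suc k) (a + b) + T k (3 + a + b)
      ∎

  -- Binomial coefficients: C(n, k-1) with the convention C(n, -1) = 0.
  _C₋₁_ : ℕ → ℕ → ℕ
  n C₋₁ zero  = 0
  n C₋₁ suc k = n C k

  pascal : ∀ n k → suc n C suc k ≡ n C k + n C suc k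
  pascal n k = sym (nCk+nC[k+1]≡[n+1]C[k+1] n k)
  pascal₋₁ : ∀ n k → suc n C k ≡ n C₋₁ k + n C k
  pascal₋₁ n zero    = refl
  pascal₋₁ n (suc k) = pascal n k

  absorption : ∀ n k → suc k * (suc n C suc k) ≡ suc n * (n C k)
  absorption zero zero = refl
  absorption zero (suc k)
    rewrite k>n⇒nCk≡0 {1} {suc (suc k)} (s≤s (s≤s z≤n))
          | k>n⇒nCk≡0 {0} {suc k} (s≤s z≤n) = *-zeroʳ (suc (suc k))
  absorption (suc n) zero = begin
    1 * (suc (suc n) C 1)  ≡⟨ *-identityˡ _ ⟩
    suc (suc n) C 1        ≡⟨ nC1≡n (suc (suc n)) ⟩
    suc (suc n)            ≡⟨ sym (*-identityʳ (suc (suc n))) ⟩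
    suc (suc n) * 1        ∎
  absorption (suc n) (suc k) = begin
    suc (suc k) * (suc (suc n) C suc (suc k))
      ≡⟨ cong (suc (suc k) *_) (pascal (suc n) (suc k)) ⟩
    suc (suc k) * (suc n C suc k + suc n C suc (suc k))
      ≡⟨ *-distribˡ-+ (suc (suc k)) (suc n C suc k) (suc n C suc (suc k)) ⟩
    (suc n C suc k + suc k * (suc n C suc k)) + suc (suc k) * (suc n C suc (suc k))
      ≡⟨ cong₂ (λ x y → (suc n C suc k + x) + y) (absorption n k) (absorption n (suc k)) ⟩
    (suc n C suc k + suc n * (n C k)) + suc n * (n C suc k)
      ≡⟨ regroup (suc n C suc k) (suc n) (n C k) (n C suc k) ⟩
    suc n C suc k + suc n * (n C k + n C suc k)
      ≡⟨ cong (λ x → suc n C suc k + suc n * x) (sym (pascal n k)) ⟩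
    suc (suc n) * (suc n C suc k)
      ∎
    where regroup : ∀ a m x y → (a + m * x) + m * y ≡ a + m * (x + y)
          regroup = solve-∀

  absorption-ratio : ∀ n k m → suc n ≡ m + suc k → suc k * (n C suc k) ≡ m * (n C k)
  absorption-ratio n k m n+1≡m+k+1 = +-cancelʳ-≡ (suc k * (n C k)) _ _ (begin
    suc k * (n C suc k) + suc k * (n C k)  ≡⟨ +-comm (suc k * (n C suc k)) _ ⟩
    suc k * (n C k) + suc k * (n C suc k)  ≡⟨ sym (*-distribˡ-+ (suc k) (n C k) (n C suc k)) ⟩
    suc k * (n C k + n C suc k)            ≡⟨ cong (suc k *_) (sym (pascal n k)) ⟩
    suc k * (suc n C suc k)                ≡⟨ absorption n k ⟩
    suc n * (n C k)                        ≡⟨ cong (_* (n C k)) n+1≡m+k+1 ⟩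
    (m + suc k) * (n C k)                  ≡⟨ *-distribʳ-+ (n C k) m (suc k) ⟩
    m * (n C k) + suc k * (n C k)          ∎)

  doubling : ∀ j → 2 * ((3 * j + 2) C j) ≡ (3 * j + 2) C suc j
  doubling j = *-cancelˡ-≡ _ _ (suc j) (begin
    suc j * (2 * (M C j))  ≡⟨ reassoc (suc j) (M C j) ⟩
    (2 * suc j) * (M C j)  ≡⟨ sym (absorption-ratio M j (2 * suc j) (row j)) ⟩
    suc j * (M C suc j)    ∎)
    where M = 3 * j + 2
          reassoc : ∀ a x → a * (2 * x) ≡ (2 * a) * x
          reassoc = solve-∀
          row : ∀ j → suc (3 * j + 2) ≡ 2 * suc j + suc j
          row = solve-∀

  T-ballot : ∀ k s → T k (suc s) + 2 * ((3 * k + s) C₋₁ k) ≡ (3 * k + s) C k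
  T-ballot zero    s       = refl
  T-ballot (suc j) zero    = begin
    T j 3 + 2 * ((3 * suc j + 0) C j)
      ≡⟨ cong (λ x → T j 3 + 2 * (x C j)) (row j) ⟩
    T j 3 + 2 * (suc M C j)
      ≡⟨ cong (λ x → T j 3 + 2 * x) (pascal₋₁ M j) ⟩
    T j 3 + 2 * (M C₋₁ j + M C j)
      ≡⟨ regroup (T j 3) (M C₋₁ j) (M C j) ⟩
    (T j 3 + 2 * (M C₋₁ j)) + 2 * (M C j)
      ≡⟨ cong₂ _+_ (T-ballot j 2) (doubling j) ⟩
    M C j + M C suc j
      ≡⟨ sym (pascal M j) ⟩
    suc M C suc j
      ≡⟨ cong (λ x → x C suc j) (sym (row j)) ⟩
    (3 * suc j + 0) C suc j
      ∎
    where M = 3 * j + 2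
          row : ∀ j → 3 * suc j + 0 ≡ suc (3 * j + 2)
          row = solve-∀
          regroup : ∀ f a b → f + 2 * (a + b) ≡ (f + 2 * a) + 2 * b
          regroup = solve-∀
  T-ballot (suc j) (suc s) = begin
    (T (suc j) (suc s) + T j (4 + s)) + 2 * ((3 * suc j + suc s) C j)
      ≡⟨ cong (λ x → (T (suc j) (suc s) + T j (4 + s)) + 2 * (x C j)) (row j s) ⟩
    (T (suc j) (suc s) + T j (4 + s)) + 2 * (suc M C j)
      ≡⟨ cong (λ x → (T (suc j) (suc s) + T j (4 + s)) + 2 * x) (pascal₋₁ M j) ⟩
    (T (suc j) (suc s) + T j (4 + s)) + 2 * (M C₋₁ j + M C j)
      ≡⟨ regroup (T (suc j) (suc s)) (T j (4 + s)) (M C₋₁ j) (M C j) ⟩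
    (T (suc j) (suc s) + 2 * (M C j)) + (T j (4 + s) + 2 * (M C₋₁ j))
      ≡⟨ cong₂ _+_ (T-ballot (suc j) s) (lower-row (T-ballot j (3 + s))) ⟩
    M C suc j + M C j
      ≡⟨ trans (+-comm (M C suc j) (M C j)) (sym (pascal M j)) ⟩
    suc M C suc j
      ≡⟨ cong (λ x → x C suc j) (sym (row j s)) ⟩
    (3 * suc j + suc s) C suc j
      ∎
    where M = 3 * suc j + s
          row : ∀ j s → 3 * suc j + suc s ≡ suc (3 * suc j + s)
          row = solve-∀
          same-row : ∀ j s → 3 * j + (3 + s) ≡ 3 * suc j + s
          same-row = solve-∀
          -- the induction hypothesis for (j, s + 3) lives on the same row M
          lower-row : T j (4 + s) + 2 * ((3 * j + (3 + s)) C₋₁ j) ≡ (3 * j + (3 + s)) C j →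
                      T j (4 + s) + 2 * (M C₋₁ j) ≡ M C j
          lower-row = subst (λ r → T j (4 + s) + 2 * (r C₋₁ j) ≡ r C j) (same-row j s)
          regroup : ∀ f g a b → (f + g) + 2 * (a + b) ≡ (f + 2 * b) + (g + 2 * a)
          regroup = solve-∀

  ballot⇒closed : ∀ b t X Y → t + 2 * Y ≡ X → b * X ≡ suc (2 * b) * Y → suc (2 * b) * t ≡ X
  ballot⇒closed b t X Y ballot ratio = +-cancelʳ-≡ (2 * (b * X)) _ _ (begin
    suc (2 * b) * t + 2 * (b * X)            ≡⟨ cong (λ z → suc (2 * b) * t + 2 * z) ratio ⟩
    suc (2 * b) * t + 2 * (suc (2 * b) * Y)  ≡⟨ factor (suc (2 * b)) t Y ⟩
    suc (2 * b) * (t + 2 * Y)                ≡⟨ cong (suc (2 * b) *_) ballot ⟩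
    suc (2 * b) * X                          ≡⟨ expand b X ⟩
    X + 2 * (b * X)                          ∎)
    where factor : ∀ a t Y → a * t + 2 * (a * Y) ≡ a * (t + 2 * Y)
          factor = solve-∀
          expand : ∀ b X → suc (2 * b) * X ≡ X + 2 * (b * X)
          expand = solve-∀

  ballot⇒closed₂ : ∀ b t X Y Z → t + 2 * Y ≡ X → b * X ≡ 2 * suc b * Y → suc b * Z ≡ suc (2 * b) * X →
                   suc (2 * b) * t ≡ Z
  ballot⇒closed₂ b t X Y Z ballot ratio ratio′ = *-cancelˡ-≡ _ _ (suc b) (+-cancelʳ-≡ (a * (b * X)) _ _ (begin
    suc b * (a * t) + a * (b * X)            ≡⟨ cong (λ z → suc b * (a * t) + a * z) ratio ⟩
    suc b * (a * t) + a * (2 * suc b * Y)    ≡⟨ factor b t Y ⟩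
    suc b * (a * (t + 2 * Y))                ≡⟨ cong (λ z → suc b * (a * z)) ballot ⟩
    suc b * (a * X)                          ≡⟨ expand b X ⟩
    a * X + a * (b * X)                      ≡⟨ cong (_+ a * (b * X)) (sym ratio′) ⟩
    suc b * Z + a * (b * X)                  ∎))
    where a = suc (2 * b)
          factor : ∀ b t Y → suc b * (suc (2 * b) * t) + suc (2 * b) * (2 * suc b * Y)
                             ≡ suc b * (suc (2 * b) * (t + 2 * Y))
          factor = solve-∀
          expand : ∀ b X → suc b * (suc (2 * b) * X) ≡ suc (2 * b) * X + suc (2 * b) * (b * X)
          expand = solve-∀

  T-closed₁ : ∀ k → suc (2 * k) * T k 1 ≡ (3 * k) C k
  T-closed₁ zero    = refl
  T-closed₁ (suc j) = ballot⇒closed (suc j) (T (suc j) 1) (n C suc j) (n C j) ballot ratio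
    where n = 3 * suc j
          ballot : T (suc j) 1 + 2 * (n C j) ≡ n C suc j
          ballot = subst (λ m → T (suc j) 1 + 2 * (m C₋₁ suc j) ≡ m C suc j) (+-identityʳ n) (T-ballot (suc j) 0)
          row : ∀ j → suc (3 * suc j) ≡ suc (2 * suc j) + suc j
          row = solve-∀
          ratio : suc j * (n C suc j) ≡ suc (2 * suc j) * (n C j)
          ratio = absorption-ratio n j (suc (2 * suc j)) (row j)

  T-closed₂ : ∀ k → suc (2 * k) * T k 2 ≡ (3 * k + 1) C (k + 1)
  T-closed₂ zero    = refl
  T-closed₂ (suc j) = trans (ballot⇒closed₂ (suc j) (T (suc j) 2) X Y Z (T-ballot (suc j) 1) ratio ratio′)
                            (cong (n C_) (+-comm 1 (suc j)))
    where n = 3 * suc j + 1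
          X = n C suc j
          Y = n C j
          Z = n C suc (suc j)
          row : ∀ j → suc (3 * suc j + 1) ≡ 2 * suc (suc j) + suc j
          row = solve-∀
          ratio : suc j * X ≡ 2 * suc (suc j) * Y
          ratio = absorption-ratio n j (2 * suc (suc j)) (row j)
          row′ : ∀ j → suc (3 * suc j + 1) ≡ suc (2 * suc j) + suc (suc j)
          row′ = solve-∀
          ratio′ : suc (suc j) * Z ≡ suc (2 * suc j) * X
          ratio′ = absorption-ratio n (suc j) (suc (2 * suc j)) (row′ j)

  T₁≡quotient : ∀ k → ((3 * k) C k) / suc (2 * k) ≡ T k 1
  T₁≡quotient k = begin
    ((3 * k) C k) / suc (2 * k)           ≡⟨ cong (_/ suc (2 * k)) (sym (T-closed₁ k)) ⟩
    (suc (2 * k) * T k 1) / suc (2 * k)   ≡⟨ cong (_/ suc (2 * k)) (*-comm (suc (2 * k)) (T k 1)) ⟩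
    (T k 1 * suc (2 * k)) / suc (2 * k)   ≡⟨ m*n/n≡m (T k 1) (suc (2 * k)) ⟩
    T k 1                                 ∎

  T₂≡quotient : ∀ k → ((3 * k + 1) C (k + 1)) / suc (2 * k) ≡ T k 2
  T₂≡quotient k = begin
    ((3 * k + 1) C (k + 1)) / suc (2 * k)  ≡⟨ cong (_/ suc (2 * k)) (sym (T-closed₂ k)) ⟩
    (suc (2 * k) * T k 2) / suc (2 * k)    ≡⟨ cong (_/ suc (2 * k)) (*-comm (suc (2 * k)) (T k 2)) ⟩
    (T k 2 * suc (2 * k)) / suc (2 * k)    ≡⟨ m*n/n≡m (T k 2) (suc (2 * k)) ⟩
    T k 2                                  ∎

-- The block recurrence and its solution in terms of the coefficients of T and T^2.
module Recurrence where

  open import Data.Nat using (ℕ; zero; suc; _+_; _*_; _<_; s≤s; parity)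
  open import Data.Nat.Properties using (+-identityʳ; +-assoc; +-comm; *-identityʳ; m≤m+n; m≤n+m)
  open import Data.Nat.Induction using (<-rec)
  open import Data.Nat.Tactic.RingSolver using (solve-∀)
  open import Data.Bool using (Bool; true; false; if_then_else_)
  open import Data.Parity using (Parity; 0ℙ; 1ℙ)
  open import Data.Product using (_×_; _,_; proj₁; proj₂)
  open import Relation.Binary.PropositionalEquality using (_≡_; refl; sym; trans; cong; cong₂; module ≡-Reasoning)
  open Series
  open ≡-Reasoning

  oddᵇ : Parity → Bool
  oddᵇ 0ℙ = false
  oddᵇ 1ℙ = true

  -- A good permutation splits as a block of size b followed by a block of size c;
  -- the pair (b, c) is admissible when the second block is empty or b is odd.
  admissible : ℕ → ℕ → Bool
  admissible b zero    = true
  admissible b (suc c) = oddᵇ (parity b)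

  weight : ℕ → ℕ → ℕ
  weight b c = if admissible b c then 1 else 0

  -- Doubling with a definitional successor step, used to split sums by parity.
  double : ℕ → ℕ
  double zero    = 0
  double (suc k) = suc (suc (double k))

  double≡2* : ∀ k → double k ≡ 2 * k
  double≡2* zero    = refl
  double≡2* (suc k) = trans (cong (λ x → suc (suc x)) (double≡2* k)) (shift k)
    where shift : ∀ k → 2 + 2 * k ≡ 2 * suc k
          shift = solve-∀
  parity-double : ∀ k → parity (double k) ≡ 0ℙ
  parity-double zero    = refl
  parity-double (suc k) = parity-double k
  parity-suc-double : ∀ k → parity (suc (double k)) ≡ 1ℙ
  parity-suc-double zero    = refl
  parity-suc-double (suc k) = parity-suc-double k

  convolve-odd : ∀ h k → convolve h (suc (double k))
               ≡ convolve (λ i j → h (double i) (suc (double j)) + h (suc (double i)) (double j)) k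
  convolve-odd h zero    = refl
  convolve-odd h (suc k) =
    trans (sym (+-assoc (h 0 (suc (double (suc k)))) (h 1 (double (suc k))) _))
          (cong ((h 0 (suc (double (suc k))) + h 1 (double (suc k))) +_) (convolve-odd (λ b c → h (suc (suc b)) c) k))

  convolve-even : ∀ h k → convolve h (double (suc k))
                ≡ convolve (λ i j → h (double i) (double (suc j)) + h (suc (double i)) (suc (double j))) k
                  + h (double (suc k)) 0
  convolve-even h zero    = sym (+-assoc (h 0 2) (h 1 1) (h 2 0))
  convolve-even h (suc k) =
    trans (sym (+-assoc (h 0 (double (suc (suc k)))) (h 1 (suc (double (suc k)))) _))
          (trans (cong (first-pair +_) (convolve-even (λ b c → h (suc (suc b)) c) k))
                 (sym (+-assoc first-pair _ _)))
    where first-pair = h 0 (double (suc (suc k))) + h 1 (suc (double (suc k)))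

  -- A sequence satisfying the block recurrence a(n+1) = Σ_{b+c=n} weight b c · a(b) a(c)
  -- is given by the ternary-tree coefficients: a(2k) = [x^k] T and a(2k+1) = [x^k] T^2.
  -- Splitting the recurrence by parity gives p_{k+1} = Σ q_i p_j and
  -- q_{k+1} = Σ q_i q_j + p_{k+1} for p_k = a(2k), q_k = a(2k+1), which is
  -- T = 1 + x T^2 · T and T^2 = T + x T^2 · T^2.
  module BlockRecurrence (a : ℕ → ℕ) (a-zero : a 0 ≡ 1)
         (a-suc : ∀ n → a (suc n) ≡ convolve (λ b c → weight b c * (a b * a c)) n) where

    private
      summand : ℕ → ℕ → ℕ
      summand b c = weight b c * (a b * a c)

      p q : ℕ → ℕ
      p k = a (double k)
      q k = a (suc (double k))

      p-suc : ∀ k → p (suc k) ≡ convolve (λ i j → q i * p j) k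
      p-suc k = trans (a-suc (suc (double k))) (trans (convolve-odd summand k)
                      (convolve-cong _ _ k (λ i j _ → only-odd-first i j)))
        where
        only-odd-first : ∀ i j → summand (double i) (suc (double j)) + summand (suc (double i)) (double j) ≡ q i * p j
        only-odd-first i zero    rewrite parity-double i = +-identityʳ _
        only-odd-first i (suc j) rewrite parity-double i | parity-suc-double i = +-identityʳ _

      q-suc : ∀ k → q (suc k) ≡ convolve (λ i j → q i * q j) k + p (suc k)
      q-suc k = trans (a-suc (double (suc k))) (trans (convolve-even summand k)
                      (cong₂ _+_ (convolve-cong _ _ k (λ i j _ → only-odd-first i j)) last-term))
        where
        only-odd-first : ∀ i j → summand (double i) (double (suc j)) + summand (suc (double i)) (suc (double j))
                                 ≡ q i * q j
        only-odd-first i j rewrite parity-double i | parity-suc-double i = +-identityʳ _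
        last-term : summand (double (suc k)) 0 ≡ p (suc k)
        last-term = begin
          (p (suc k) * a 0) + 0  ≡⟨ +-identityʳ _ ⟩
          p (suc k) * a 0        ≡⟨ cong (p (suc k) *_) a-zero ⟩
          p (suc k) * 1          ≡⟨ *-identityʳ _ ⟩
          p (suc k)              ∎

      q-zero : q 0 ≡ 1
      q-zero = trans (a-suc 0) (trans (+-identityʳ _) (cong (λ x → x * x) a-zero))

      Agrees : ℕ → Set
      Agrees k = p k ≡ T k 1 × q k ≡ T k 2

      agrees : ∀ k → Agrees k
      agrees = <-rec Agrees step
        where
        step : ∀ k → (∀ {i} → i < k → Agrees i) → Agrees k
        step zero    _  = a-zero , q-zero
        step (suc k) ih = p-agrees , q-agrees
          where
          ih-left : ∀ i j → i + j ≡ k → Agrees i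
          ih-left i j refl = ih (s≤s (m≤m+n i j))
          ih-right : ∀ i j → i + j ≡ k → Agrees j
          ih-right i j refl = ih (s≤s (m≤n+m j i))
          p-agrees : p (suc k) ≡ T (suc k) 1
          p-agrees = begin
            p (suc k)                           ≡⟨ p-suc k ⟩
            convolve (λ i j → q i * p j) k      ≡⟨ convolve-cong _ _ k (λ i j e →
                                                     cong₂ _*_ (proj₂ (ih-left i j e)) (proj₁ (ih-right i j e))) ⟩
            convolve (λ i j → T i 2 * T j 1) k  ≡⟨ T-convolution k 2 1 ⟩
            T (suc k) 1                         ∎
          q-agrees : q (suc k) ≡ T (suc k) 2
          q-agrees = begin
            q (suc k)                                       ≡⟨ q-suc k ⟩
            convolve (λ i j → q i * q j) k + p (suc k)      ≡⟨ cong₂ _+_ (convolve-cong _ _ k (λ i j e →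
                                                                 cong₂ _*_ (proj₂ (ih-left i j e)) (proj₂ (ih-right i j e))))
                                                                 p-agrees ⟩
            convolve (λ i j → T i 2 * T j 2) k + T (suc k) 1 ≡⟨ cong (_+ T (suc k) 1) (T-convolution k 2 2) ⟩
            T k 4 + T (suc k) 1                             ≡⟨ +-comm (T k 4) _ ⟩
            T (suc k) 2                                     ∎

    even-terms : ∀ k → a (2 * k) ≡ T k 1
    even-terms k = trans (cong a (sym (double≡2* k))) (proj₁ (agrees k))

    odd-terms : ∀ k → a (2 * k + 1) ≡ T k 2
    odd-terms k = trans (cong a (trans (+-comm (2 * k) 1) (cong suc (sym (double≡2* k))))) (proj₂ (agrees k))

-- Permutations as lists of naturals, 213-avoidance, and the decomposition at the first entry.
module ListPermutations where

  open import Data.Nat using (ℕ; suc; _+_; _∸_; _≤_; _<_; z≤n; s≤s; _<?_; _≟_)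
  open import Data.Nat.Properties
    using (+-cancelʳ-<; +-cancelʳ-≡; +-monoˡ-<; +-suc; <-asym; <-cmp; <-irrefl; <-trans; <-≤-trans; <⇒≤;
           m+n∸n≡m; m∸n+n≡m; m≤n+m; suc-injective; ∸-monoˡ-<; ≤-antisym; ≤-pred)
  open import Data.List using (List; []; _∷_; _++_; [_]; map; filter; length; upTo)
  import Data.List.Properties as List
  open import Data.List.Relation.Unary.All as All using (All; []; _∷_)
  import Data.List.Relation.Unary.All.Properties as All
  open import Data.List.Relation.Unary.Any as Any using (here; there)
  open import Data.List.Relation.Unary.AllPairs using ([]; _∷_)
  open import Data.List.Relation.Unary.Unique.Propositional using (Unique)
  import Data.List.Relation.Unary.Unique.Propositional.Properties as Unique
  open import Data.List.Membership.Propositional using (_∈_)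
  open import Data.List.Membership.Propositional.Properties using (∈-filter⁺; ∈-filter⁻; ∈-upTo⁺; ∈-upTo⁻; ∈-++⁺ʳ)
  open import Data.List.Membership.DecPropositional _≟_ using (_∈?_)
  open import Data.List.Relation.Binary.Subset.Propositional using (_⊆_)
  open import Data.Product using (_×_; _,_; proj₁; proj₂)
  open import Data.Unit using (⊤; tt)
  open import Data.Empty using (⊥-elim)
  open import Relation.Nullary using (¬_; yes; no)
  open import Relation.Nullary.Decidable using (¬?)
  open import Relation.Binary.Definitions using (DecidableEquality; tri<; tri≈; tri>)
  open import Relation.Binary.PropositionalEquality using (_≡_; _≢_; refl; sym; trans; cong; cong₂; subst; module ≡-Reasoning)
  open import Function using (_∘_)
  open import Function.Bundles using (_⇔_; mk⇔; Equivalence)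
  open Equivalence using (to; from)

  -- Pigeonhole principle: a duplicate-free list contained in ys is no longer than ys.
  -- Removing the head x from ys strictly shortens ys and keeps the tail contained.
  unique-⊆⇒length≤ : ∀ {A : Set} (_≟ᴬ_ : DecidableEquality A) {xs ys : List A} →
                     Unique xs → xs ⊆ ys → length xs ≤ length ys
  unique-⊆⇒length≤ _≟ᴬ_ {[]}     _             _  = z≤n
  unique-⊆⇒length≤ _≟ᴬ_ {x ∷ xs} {ys} (x∉xs ∷ u) xs⊆ys =
    <-≤-trans (s≤s (unique-⊆⇒length≤ _≟ᴬ_ u tail⊆)) shorter
    where
    ys-x = filter (λ y → ¬? (y ≟ᴬ x)) ys
    tail⊆ : xs ⊆ ys-x
    tail⊆ z∈xs = ∈-filter⁺ _ (xs⊆ys (there z∈xs)) (λ z≡x → All.lookup x∉xs z∈xs (sym z≡x))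
    shorter : length ys-x < length ys
    shorter = List.filter-notAll _ ys (Any.map (λ x≡y y≢x → y≢x (sym x≡y)) (xs⊆ys (here refl)))

  -- ℓ lists each of 0, 1, …, n-1 exactly once (a permutation of [n], written 0-based).
  record PermList (n : ℕ) (ℓ : List ℕ) : Set where
    constructor perm
    field
      distinct : Unique ℓ
      bounded  : All (_< n) ℓ
      size     : length ℓ ≡ n
  open PermList

  PermList-resize : ∀ {n ℓ} → PermList n ℓ → PermList (length ℓ) ℓ
  PermList-resize {ℓ = ℓ} π = subst (λ m → PermList m ℓ) (sym (size π)) π

  -- Every value below n occurs in a permutation of [n]: otherwise ℓ would be a
  -- duplicate-free list of length n inside the n - 1 values of [n] other than k.
  PermList-complete : ∀ {n ℓ} → PermList n ℓ → ∀ {k} → k < n → k ∈ ℓ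
  PermList-complete {n} {ℓ} π {k} k<n with k ∈? ℓ
  ... | yes k∈ℓ = k∈ℓ
  ... | no  k∉ℓ = ⊥-elim (<-irrefl refl (<-≤-trans others<n (subst (_≤ length others) (size π) ℓ⊆others)))
    where
    others = filter (λ j → ¬? (j ≟ k)) (upTo n)
    ℓ⊆others : length ℓ ≤ length others
    ℓ⊆others = unique-⊆⇒length≤ _≟_ (distinct π)
                 (λ {x} x∈ℓ → ∈-filter⁺ _ (∈-upTo⁺ (All.lookup (bounded π) x∈ℓ))
                                         (λ x≡k → k∉ℓ (subst (_∈ ℓ) x≡k x∈ℓ)))
    others<n : length others < n
    others<n = subst (length others <_) (List.length-upTo n)
                 (List.filter-notAll _ (upTo n) (Any.map (λ k≡x x≢k → x≢k (sym k≡x)) (∈-upTo⁺ k<n)))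

  init⁺ : ℕ → List ℕ → List ℕ
  init⁺ x []      = []
  init⁺ x (y ∷ r) = x ∷ init⁺ y r

  last⁺ : ℕ → List ℕ → ℕ
  last⁺ x []      = x
  last⁺ x (y ∷ r) = last⁺ y r

  init⁺-last⁺ : ∀ x r → init⁺ x r ++ last⁺ x r ∷ [] ≡ x ∷ r
  init⁺-last⁺ x []      = refl
  init⁺-last⁺ x (y ∷ r) = cong (x ∷_) (init⁺-last⁺ y r)

  -- A permutation of [N] has exactly m entries below m, for every m ≤ N: they are
  -- distinct values among 0, …, m-1, and each of these values occurs.
  PermList-count-below : ∀ {N ℓ m} → PermList N ℓ → m ≤ N → length (filter (_<? m) ℓ) ≡ m
  PermList-count-below {ℓ = ℓ} {m} π m≤N = ≤-antisym
    (subst (length below ≤_) (List.length-upTo m)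
      (unique-⊆⇒length≤ _≟_ (Unique.filter⁺ (_<? m) (distinct π))
        (λ k∈ → ∈-upTo⁺ (proj₂ (∈-filter⁻ (_<? m) {xs = ℓ} k∈)))))
    (subst (_≤ length below) (List.length-upTo m)
      (unique-⊆⇒length≤ _≟_ (Unique.upTo⁺ m)
        (λ k∈ → let k<m = ∈-upTo⁻ k∈ in ∈-filter⁺ (_<? m) (PermList-complete π (<-≤-trans k<m m≤N)) k<m)))
    where below = filter (_<? m) ℓ

  smaller-before-last : ∀ {b x r} → PermList b (x ∷ r) →
                        length (filter (_<? last⁺ x r) (init⁺ x r)) ≡ last⁺ x r
  smaller-before-last {b} {x} {r} π = begin
    length (filter (_<? L) I)
      ≡⟨ cong length (sym (List.++-identityʳ (filter (_<? L) I))) ⟩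
    length (filter (_<? L) I ++ [])
      ≡⟨ cong (λ z → length (filter (_<? L) I ++ z)) (sym (List.filter-reject (_<? L) {xs = []} (<-irrefl refl))) ⟩
    length (filter (_<? L) I ++ filter (_<? L) [ L ])
      ≡⟨ cong length (sym (List.filter-++ (_<? L) I [ L ])) ⟩
    length (filter (_<? L) (I ++ [ L ]))
      ≡⟨ cong (length ∘ filter (_<? L)) (init⁺-last⁺ x r) ⟩
    length (filter (_<? L) (x ∷ r))
      ≡⟨ PermList-count-below π (<⇒≤ L<b) ⟩
    L
      ∎
    where
    open ≡-Reasoning
    I = init⁺ x r
    L = last⁺ x r
    L<b = All.lookup (bounded π) (subst (L ∈_) (init⁺-last⁺ x r) (∈-++⁺ʳ I (here refl)))

  -- Order embeddings of ℕ: maps that preserve and reflect <.  Shifting by a constant is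
  -- one; pattern conditions depend only on relative order, so they are invariant.
  OrderEmbedding : (ℕ → ℕ) → Set
  OrderEmbedding f = ∀ {x y} → (x < y) ⇔ (f x < f y)

  +-orderEmbedding : ∀ k → OrderEmbedding (_+ k)
  +-orderEmbedding k {x} {y} = mk⇔ (+-monoˡ-< k) (+-cancelʳ-< k x y)

  shift : ℕ → List ℕ → List ℕ
  shift k = map (_+ k)

  shift-above : ∀ c β → All (c <_) (shift (suc c) β)
  shift-above c β = All.map⁺ (All.universal (λ z → subst (c <_) (sym (+-suc z c)) (s≤s (m≤n+m c z))) β)

  -- glue β γ = m (β + m + 1) γ with m = |γ|: the first entry m, then a copy of β lying
  -- above m, then γ lying below m.  Every 213-avoiding permutation has this shape.
  glue : List ℕ → List ℕ → List ℕ
  glue β γ = length γ ∷ (shift (suc (length γ)) β ++ γ)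

  PermList-glue : ∀ {b c β γ} → PermList b β → PermList c γ → PermList (suc (b + c)) (glue β γ)
  PermList-glue {b} {c} {β} {γ} (perm uβ bβ refl) (perm uγ bγ refl) =
    perm (head-fresh ∷ Unique.++⁺ (Unique.map⁺ (+-cancelʳ-≡ k _ _) uβ) uγ disjoint)
         (s≤s (m≤n+m c b) ∷ All.++⁺ (All.map⁺ (All.map (λ {v} v<b → subst (v + k <_) (+-suc b c) (+-monoˡ-< k v<b)) bβ))
                                    (All.map (λ v<c → <-trans v<c (s≤s (m≤n+m c b))) bγ))
         (cong suc (trans (List.length-++ (shift k β)) (cong (_+ c) (List.length-map (_+ k) β))))
    where
    k = suc c
    above = shift-above c β
    head-fresh : All (c ≢_) (shift k β ++ γ)
    head-fresh = All.++⁺ (All.map (λ c<v c≡v → <-irrefl c≡v c<v) above)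
                         (All.map (λ v<c c≡v → <-irrefl (sym c≡v) v<c) bγ)
    disjoint : ∀ {v} → ¬ (v ∈ shift k β × v ∈ γ)
    disjoint (v∈β′ , v∈γ) = <-asym (All.lookup above v∈β′) (All.lookup bγ v∈γ)

  -- NoBelowThenAbove x ys: no entry of ys below x is followed, later in ys, by an entry
  -- above x; i.e. x is not the "2" of a 213 pattern x ⋯ y ⋯ z.
  NoBelowThenAbove : ℕ → List ℕ → Set
  NoBelowThenAbove x []       = ⊤
  NoBelowThenAbove x (y ∷ ys) = (y < x → All (λ z → ¬ x < z) ys) × NoBelowThenAbove x ys

  -- 213-avoidance of a list, by recursion on the position of the "2".
  Avoids213ᴸ : List ℕ → Set
  Avoids213ᴸ []       = ⊤
  Avoids213ᴸ (x ∷ xs) = NoBelowThenAbove x xs × Avoids213ᴸ xs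

  noBelowThenAbove-below : ∀ {x} ys → All (_< x) ys → NoBelowThenAbove x ys
  noBelowThenAbove-below []       _           = tt
  noBelowThenAbove-below (y ∷ ys) (_ ∷ ys<x) =
    (λ _ → All.map (λ z<x x<z → <-asym z<x x<z) ys<x) , noBelowThenAbove-below ys ys<x

  noBelowThenAbove-split : ∀ {x} xs ys → All (x <_) xs → All (_< x) ys → NoBelowThenAbove x (xs ++ ys)
  noBelowThenAbove-split []       ys _             ys<x = noBelowThenAbove-below ys ys<x
  noBelowThenAbove-split (y ∷ xs) ys (x<y ∷ x<xs) ys<x =
    (λ y<x → ⊥-elim (<-asym y<x x<y)) , noBelowThenAbove-split xs ys x<xs ys<x

  noBelowThenAbove-++ : ∀ {x} xs ys → All (_< x) ys →
                        NoBelowThenAbove x (xs ++ ys) ⇔ NoBelowThenAbove x xs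
  noBelowThenAbove-++ []       ys ys<x = mk⇔ (λ _ → tt) (λ _ → noBelowThenAbove-below ys ys<x)
  noBelowThenAbove-++ (y ∷ xs) ys ys<x = mk⇔
    (λ (after , rest) → (λ y<x → All.++⁻ˡ xs (after y<x)) , to (noBelowThenAbove-++ xs ys ys<x) rest)
    (λ (after , rest) → (λ y<x → All.++⁺ (after y<x) (All.map (λ z<x x<z → <-asym z<x x<z) ys<x))
                        , from (noBelowThenAbove-++ xs ys ys<x) rest)

  avoids-++ : ∀ xs ys → All (λ a → All (_< a) ys) xs →
              Avoids213ᴸ (xs ++ ys) ⇔ (Avoids213ᴸ xs × Avoids213ᴸ ys)
  avoids-++ []       ys _              = mk⇔ (tt ,_) proj₂
  avoids-++ (x ∷ xs) ys (ys<x ∷ ys<xs) = mk⇔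
    (λ (nx , av) → let (avx , avy) = to (avoids-++ xs ys ys<xs) av
                   in (to (noBelowThenAbove-++ xs ys ys<x) nx , avx) , avy)
    (λ ((nx , avx) , avy) → from (noBelowThenAbove-++ xs ys ys<x) nx , from (avoids-++ xs ys ys<xs) (avx , avy))

  module _ {f : ℕ → ℕ} (emb : OrderEmbedding f) where

    noBelowThenAbove-map : ∀ x ys → NoBelowThenAbove (f x) (map f ys) ⇔ NoBelowThenAbove x ys
    noBelowThenAbove-map x []       = mk⇔ (λ _ → tt) (λ _ → tt)
    noBelowThenAbove-map x (y ∷ ys) = mk⇔
      (λ (after , rest) → (λ y<x → All.map (λ ¬fx<fz x<z → ¬fx<fz (to emb x<z)) (All.map⁻ (after (to emb y<x))))
                          , to (noBelowThenAbove-map x ys) rest)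
      (λ (after , rest) → (λ fy<fx → All.map⁺ (All.map (λ ¬x<z fx<fz → ¬x<z (from emb fx<fz)) (after (from emb fy<fx))))
                          , from (noBelowThenAbove-map x ys) rest)

    avoids-map : ∀ xs → Avoids213ᴸ (map f xs) ⇔ Avoids213ᴸ xs
    avoids-map []       = mk⇔ (λ _ → tt) (λ _ → tt)
    avoids-map (x ∷ xs) = mk⇔
      (λ (nx , av) → to (noBelowThenAbove-map x xs) nx , to (avoids-map xs) av)
      (λ (nx , av) → from (noBelowThenAbove-map x xs) nx , from (avoids-map xs) av)

  -- glue β γ avoids 213 iff β and γ do: its first entry sits between the two blocks.
  glue-avoids : ∀ β γ → All (_< length γ) γ → Avoids213ᴸ (glue β γ) ⇔ (Avoids213ᴸ β × Avoids213ᴸ γ)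
  glue-avoids β γ γ<c = mk⇔
    (λ (_ , av) → let (avβ′ , avγ) = to (avoids-++ (shift k β) γ blocks) av
                  in to (avoids-map (+-orderEmbedding k) β) avβ′ , avγ)
    (λ (avβ , avγ) → noBelowThenAbove-split (shift k β) γ (shift-above c β) γ<c
                     , from (avoids-++ (shift k β) γ blocks) (from (avoids-map (+-orderEmbedding k) β) avβ , avγ))
    where
    c = length γ
    k = suc c
    blocks : All (λ a → All (_< a) γ) (shift k β)
    blocks = All.map (λ c<a → All.map (λ z<c → <-trans z<c c<a) γ<c) (shift-above c β)

  above-then-below : ∀ m rest → NoBelowThenAbove m rest → All (m ≢_) rest →
                     rest ≡ filter (m <?_) rest ++ filter (_<? m) rest
  above-then-below m []      _                 _             = refl
  above-then-below m (y ∷ r) (after , rest-ok) (m≢y ∷ m≢r) with <-cmp y m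
  ... | tri≈ _ y≡m _ = ⊥-elim (m≢y (sym y≡m))
  ... | tri> _ _ m<y = trans (cong (y ∷_) (above-then-below m r rest-ok m≢r))
                             (sym (cong₂ _++_ (List.filter-accept (m <?_) m<y) (List.filter-reject (_<? m) (<-asym m<y))))
  ... | tri< y<m _ _ = sym (cong₂ _++_ (List.filter-none (m <?_) {xs = y ∷ r} (<-asym y<m ∷ after y<m))
                                        (List.filter-all (_<? m) {xs = y ∷ r} (y<m ∷ All.zipWith below (after y<m , m≢r))))
    where below : ∀ {z} → ¬ m < z × m ≢ z → z < m
          below {z} (¬m<z , m≢z) with <-cmp z m
          ... | tri< z<m _ _ = z<m
          ... | tri≈ _ z≡m _ = ⊥-elim (m≢z (sym z≡m))
          ... | tri> _ _ m<z = ⊥-elim (¬m<z m<z)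

  record Glued (P : ℕ → List ℕ → Set) (n : ℕ) (ℓ : List ℕ) : Set where
    constructor glued
    field
      {b c}   : ℕ
      {β γ}   : List ℕ
      sizes   : b + c ≡ n
      left    : P b β
      right   : P c γ
      shape   : ℓ ≡ glue β γ

  -- Every permutation of [n+1] whose first entry is not the "2" of a 213 is a gluing:
  -- with m the first entry, γ lists the entries below m and β the entries above m, lowered.
  glue-split : ∀ {n m rest} → PermList (suc n) (m ∷ rest) → NoBelowThenAbove m rest →
               Glued PermList n (m ∷ rest)
  glue-split {n} {m} {rest} π@(perm (m∉rest ∷ u) (m<n+1 ∷ rest<n+1) size≡) no213 =
    glued (m∸n+n≡m m≤n) (perm uβ bβ lβ) (perm uγ γ<m lγ) shape
    where
    A = filter (m <?_) rest
    γ = filter (_<? m) rest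
    β = map (_∸ suc m) A
    m≤n = ≤-pred m<n+1
    m<A : All (m <_) A
    m<A = All.tabulate (λ a∈ → proj₂ (∈-filter⁻ (m <?_) {xs = rest} a∈))
    γ<m : All (_< m) γ
    γ<m = All.tabulate (λ a∈ → proj₂ (∈-filter⁻ (_<? m) {xs = rest} a∈))
    uγ = Unique.filter⁺ (_<? m) u
    lγ : length γ ≡ m
    lγ = trans (cong length (sym (List.filter-reject (_<? m) {xs = rest} (<-irrefl refl))))
               (PermList-count-below π (<⇒≤ m<n+1))
    rest≡A++γ = above-then-below m rest no213 m∉rest
    lA : length A ≡ n ∸ m
    lA = begin
      length A                   ≡⟨ sym (m+n∸n≡m (length A) m) ⟩
      length A + m ∸ m           ≡⟨ cong (λ z → length A + z ∸ m) (sym lγ) ⟩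
      length A + length γ ∸ m    ≡⟨ cong (_∸ m) (sym (List.length-++ A)) ⟩
      length (A ++ γ) ∸ m        ≡⟨ cong (λ z → length z ∸ m) (sym rest≡A++γ) ⟩
      length rest ∸ m            ≡⟨ cong (λ z → z ∸ m) (suc-injective size≡) ⟩
      n ∸ m                      ∎
      where open ≡-Reasoning
    A≡shiftβ : A ≡ shift (suc m) β
    A≡shiftβ = sym (trans (sym (List.map-∘ A)) (List.map-id-local (All.map m∸n+n≡m m<A)))
    uβ : Unique β
    uβ = Unique.map⁻ (subst Unique A≡shiftβ (Unique.filter⁺ (m <?_) u))
    bβ : All (_< n ∸ m) β
    bβ = All.map⁺ (All.zipWith (λ (a<n+1 , m<a) → ∸-monoˡ-< a<n+1 m<a)
                    (All.tabulate (λ a∈ → All.lookup rest<n+1 (proj₁ (∈-filter⁻ (m <?_) {xs = rest} a∈))) , m<A))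
    lβ : length β ≡ n ∸ m
    lβ = trans (List.length-map (_∸ suc m) A) lA
    shape : m ∷ rest ≡ glue β γ
    shape = cong₂ _∷_ (sym lγ) (trans rest≡A++γ (cong (_++ γ) (trans A≡shiftβ (cong (λ z → shift (suc z) β) (sym lγ)))))

-- The barred-pattern condition (every descent has an odd number of earlier entries in
-- between) on lists, and its behaviour under gluing.
module Descents where

  open import Data.Nat using (ℕ; suc; _+_; _≤_; _<_; s≤s; _<?_)
  open import Data.Nat.Properties using (+-cancelʳ-<; +-monoˡ-<; +-suc; <-asym; <-trans; <-≤-trans; <⇒≤; m≤n+m; ≤-refl)
  open import Data.List using (List; []; _∷_; _++_; _∷ʳ_; [_]; map; filter; length)
  import Data.List.Properties as List
  open import Data.List.Relation.Unary.All as All using (All; []; _∷_)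
  import Data.List.Relation.Unary.All.Properties as All
  open import Data.List.Relation.Unary.Any using (here; there)
  open import Data.List.Membership.Propositional using (_∈_)
  open import Data.Product using (_×_; _,_; proj₁)
  open import Data.Unit using (⊤; tt)
  open import Data.Empty using (⊥; ⊥-elim)
  open import Relation.Nullary using (¬_; Dec; yes; no)
  open import Relation.Nullary.Decidable using (_×-dec_)
  open import Relation.Binary.PropositionalEquality using (_≡_; refl; sym; trans; cong; subst; module ≡-Reasoning)
  open import Function using (_∘_)
  open import Function.Bundles using (_⇔_; mk⇔; Equivalence)
  open Equivalence using (to; from)
  open ListPermutations

  filter-map : ∀ {A B : Set} {P : B → Set} (P? : ∀ x → Dec (P x)) (f : A → B) xs →
               filter P? (map f xs) ≡ map f (filter (P? ∘ f) xs)
  filter-map P? f []       = refl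
  filter-map P? f (x ∷ xs) with P? (f x)
  ... | yes _ = cong (f x ∷_) (filter-map P? f xs)
  ... | no  _ = filter-map P? f xs

  between? : (b a j : ℕ) → Dec (b < j × j < a)
  between? b a j = (b <? j) ×-dec (j <? a)

  countBetween : ℕ → ℕ → List ℕ → ℕ
  countBetween b a pre = length (filter (between? b a) pre)

  -- OddDescentsFrom pre x r: in the word pre ++ x ∷ r, every descent a > b at or after x
  -- has an odd number of earlier entries with value between b and a.
  OddDescentsFrom : List ℕ → ℕ → List ℕ → Set
  OddDescentsFrom pre x []      = ⊤
  OddDescentsFrom pre x (y ∷ r) = (y < x → Odd (countBetween y x pre)) × OddDescentsFrom (pre ∷ʳ x) y r

  -- The list form of avoiding the barred pattern 2̄°-31.
  OddDescentsᴸ : List ℕ → Set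
  OddDescentsᴸ []      = ⊤
  OddDescentsᴸ (x ∷ r) = OddDescentsFrom [] x r

  countBetween-++ : ∀ b a xs ys → countBetween b a (xs ++ ys) ≡ countBetween b a xs + countBetween b a ys
  countBetween-++ b a xs ys = trans (cong length (List.filter-++ (between? b a) xs ys))
                                    (List.length-++ (filter (between? b a) xs))

  countBetween-map : ∀ {f} → OrderEmbedding f → ∀ b a xs → countBetween (f b) (f a) (map f xs) ≡ countBetween b a xs
  countBetween-map {f} emb b a xs = begin
    length (filter (between? (f b) (f a)) (map f xs))
      ≡⟨ cong length (filter-map (between? (f b) (f a)) f xs) ⟩
    length (map f (filter (between? (f b) (f a) ∘ f) xs))
      ≡⟨ List.length-map f (filter (between? (f b) (f a) ∘ f) xs) ⟩
    length (filter (between? (f b) (f a) ∘ f) xs)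
      ≡⟨ cong length (List.filter-≐ _ (between? b a)
           ((λ (fb<fj , fj<fa) → from emb fb<fj , from emb fj<fa) , (λ (b<j , j<a) → to emb b<j , to emb j<a)) xs) ⟩
    length (filter (between? b a) xs)
      ∎
    where open ≡-Reasoning

  Irrelevant : List ℕ → List ℕ → Set
  Irrelevant Q S = ∀ {q a b} → q ∈ Q → a ∈ S → b ∈ S → ¬ (b < q × q < a)

  descents-drop-prefix : ∀ Q pre x r → Irrelevant Q (x ∷ r) →
                         OddDescentsFrom (Q ++ pre) x r ⇔ OddDescentsFrom pre x r
  descents-drop-prefix Q pre x []      irr = mk⇔ (λ _ → tt) (λ _ → tt)
  descents-drop-prefix Q pre x (y ∷ r) irr = mk⇔
    (λ (here-ok , later) → (λ y<x → subst Odd same-count (here-ok y<x))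
                           , to ih (subst (λ P → OddDescentsFrom P y r) (List.++-assoc Q pre [ x ]) later))
    (λ (here-ok , later) → (λ y<x → subst Odd (sym same-count) (here-ok y<x))
                           , subst (λ P → OddDescentsFrom P y r) (sym (List.++-assoc Q pre [ x ])) (from ih later))
    where
    ih = descents-drop-prefix Q (pre ∷ʳ x) y r (λ q∈ a∈ b∈ → irr q∈ (there a∈) (there b∈))
    same-count : countBetween y x (Q ++ pre) ≡ countBetween y x pre
    same-count = trans (countBetween-++ y x Q pre)
                       (cong (_+ countBetween y x pre)
                             (cong length (List.filter-none (between? y x)
                               (All.tabulate (λ q∈ → irr q∈ (here refl) (there (here refl)))))))

  descents-map : ∀ {f} → OrderEmbedding f → ∀ pre x r →
                 OddDescentsFrom (map f pre) (f x) (map f r) ⇔ OddDescentsFrom pre x r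
  descents-map emb pre x []      = mk⇔ (λ _ → tt) (λ _ → tt)
  descents-map {f} emb pre x (y ∷ r) = mk⇔
    (λ (here-ok , later) → (λ y<x → subst Odd (countBetween-map emb y x pre) (here-ok (to emb y<x)))
                           , to ih (subst (λ P → OddDescentsFrom P (f y) (map f r)) (sym (List.map-++ f pre [ x ])) later))
    (λ (here-ok , later) → (λ fy<fx → subst Odd (sym (countBetween-map emb y x pre)) (here-ok (from emb fy<fx)))
                           , subst (λ P → OddDescentsFrom P (f y) (map f r)) (List.map-++ f pre [ x ]) (from ih later))
    where ih = descents-map emb (pre ∷ʳ x) y r

  descents-split : ∀ pre x r s → OddDescentsFrom pre x (r ++ s)
                   ⇔ (OddDescentsFrom pre x r × OddDescentsFrom (pre ++ init⁺ x r) (last⁺ x r) s)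
  descents-split pre x []      s = mk⇔
    (λ d → tt , subst (λ P → OddDescentsFrom P x s) (sym (List.++-identityʳ pre)) d)
    (λ (_ , d) → subst (λ P → OddDescentsFrom P x s) (List.++-identityʳ pre) d)
  descents-split pre x (y ∷ r) s = mk⇔
    (λ (here-ok , later) → let (d₁ , d₂) = to ih later
                           in (here-ok , d₁) , subst (λ P → OddDescentsFrom P (last⁺ y r) s) (List.++-assoc pre [ x ] (init⁺ y r)) d₂)
    (λ ((here-ok , d₁) , d₂) → here-ok
                             , from ih (d₁ , subst (λ P → OddDescentsFrom P (last⁺ y r) s) (sym (List.++-assoc pre [ x ] (init⁺ y r))) d₂))
    where ih = descents-split (pre ∷ʳ x) y r s

  init⁺-map : ∀ f x r → init⁺ (f x) (map f r) ≡ map f (init⁺ x r)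
  init⁺-map f x []      = refl
  init⁺-map f x (y ∷ r) = cong (f x ∷_) (init⁺-map f y r)
  last⁺-map : ∀ f x r → last⁺ (f x) (map f r) ≡ f (last⁺ x r)
  last⁺-map f x []      = refl
  last⁺-map f x (y ∷ r) = last⁺-map f y r

  Junction : List ℕ → List ℕ → Set
  Junction β       []      = ⊤
  Junction []      (_ ∷ _) = ⊥
  Junction (x ∷ r) (_ ∷ _) = Odd (suc (last⁺ x r))

  -- At the junction of glue β γ the descent from the last entry L + c + 1 of the upper block
  -- to any g < c sees, between the two, the first entry c and the L entries of β below L.
  junction-count : ∀ {b} c g x r → g < c → PermList b (x ∷ r) →
                   countBetween g (last⁺ x r + suc c) (c ∷ shift (suc c) (init⁺ x r)) ≡ suc (last⁺ x r)
  junction-count c g x r g<c π = begin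
    length (filter (between? g (L + k)) (c ∷ shift k I))
      ≡⟨ cong length (List.filter-accept (between? g (L + k)) (g<c , c<L+k)) ⟩
    suc (length (filter (between? g (L + k)) (shift k I)))
      ≡⟨ cong (suc ∘ length) (filter-map (between? g (L + k)) (_+ k) I) ⟩
    suc (length (map (_+ k) (filter (between? g (L + k) ∘ (_+ k)) I)))
      ≡⟨ cong suc (List.length-map (_+ k) (filter (between? g (L + k) ∘ (_+ k)) I)) ⟩
    suc (length (filter (between? g (L + k) ∘ (_+ k)) I))
      ≡⟨ cong (suc ∘ length) (List.filter-≐ _ (_<? L)
           ((λ (_ , i+k<L+k) → +-cancelʳ-< k _ _ i+k<L+k) , (λ i<L → g<i+k _ , +-monoˡ-< k i<L)) I) ⟩
    suc (length (filter (_<? L) I))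
      ≡⟨ cong suc (smaller-before-last π) ⟩
    suc L
      ∎
    where
    open ≡-Reasoning
    k = suc c
    L = last⁺ x r
    I = init⁺ x r
    c<+k : ∀ i → c < i + k
    c<+k i = subst (c <_) (sym (+-suc i c)) (s≤s (m≤n+m c i))
    c<L+k = c<+k L
    g<i+k : ∀ i → g < i + k
    g<i+k i = <-trans g<c (c<+k i)

  -- The upper block of glue β γ has the descents of β: the first entry c lies below it.
  descents-upper-block : ∀ c x r → OddDescentsFrom [ c ] (x + suc c) (shift (suc c) r) ⇔ OddDescentsFrom [] x r
  descents-upper-block c x r = mk⇔
    (to (descents-map (+-orderEmbedding (suc c)) [] x r) ∘ to (descents-drop-prefix [ c ] [] (x + suc c) (shift (suc c) r) irr))
    (from (descents-drop-prefix [ c ] [] (x + suc c) (shift (suc c) r) irr) ∘ from (descents-map (+-orderEmbedding (suc c)) [] x r))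
    where
    irr : Irrelevant [ c ] (x + suc c ∷ shift (suc c) r)
    irr (here refl) _ b∈ (b<c , _) = <-asym b<c (All.lookup (shift-above c (x ∷ r)) b∈)

  -- The lower block of glue β γ has the descents of γ: everything before it lies above it.
  descents-lower-block : ∀ Q g gs → All (λ q → All (_< q) (g ∷ gs)) Q → OddDescentsFrom Q g gs ⇔ OddDescentsFrom [] g gs
  descents-lower-block Q g gs Q>γ = mk⇔
    (to (descents-drop-prefix Q [] g gs irr) ∘ subst (λ P → OddDescentsFrom P g gs) (sym (List.++-identityʳ Q)))
    (subst (λ P → OddDescentsFrom P g gs) (List.++-identityʳ Q) ∘ from (descents-drop-prefix Q [] g gs irr))
    where
    irr : Irrelevant Q (g ∷ gs)
    irr q∈ a∈ _ (_ , q<a) = <-asym q<a (All.lookup (All.lookup Q>γ q∈) a∈)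

  descents-across-junction : ∀ {b} x r g gs → PermList b (x ∷ r) → All (_< suc (length gs)) (g ∷ gs) →
    OddDescentsFrom (suc (length gs) ∷ init⁺ (x + suc (suc (length gs))) (shift (suc (suc (length gs))) r))
                    (last⁺ (x + suc (suc (length gs))) (shift (suc (suc (length gs))) r)) (g ∷ gs)
    ⇔ (Odd (suc (last⁺ x r)) × OddDescentsFrom [] g gs)
  descents-across-junction x r g gs π γ<c
    rewrite init⁺-map (_+ suc (suc (length gs))) x r | last⁺-map (_+ suc (suc (length gs))) x r = mk⇔
    (λ (junction , later) → subst Odd count (junction g<L+k) , to lower later)
    (λ (junction , later) → (λ _ → subst Odd (sym count) junction) , from lower later)
    where
    c = suc (length gs)
    k = suc c
    L = last⁺ x r
    I = init⁺ x r
    count = junction-count c g x r (All.lookup γ<c (here refl)) π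
    c≤+k : ∀ i → c ≤ i + k
    c≤+k i = <⇒≤ (subst (c <_) (sym (+-suc i c)) (s≤s (m≤n+m c i)))
    below : ∀ {q} → c ≤ q → All (_< q) (g ∷ gs)
    below c≤q = All.map (λ v<c → <-≤-trans v<c c≤q) γ<c
    g<L+k = All.lookup (below (c≤+k L)) (here refl)
    lower = descents-lower-block ((c ∷ shift k I) ∷ʳ (L + k)) g gs
              (All.++⁺ (below ≤-refl ∷ All.map⁺ (All.universal (below ∘ c≤+k) I)) (below (c≤+k L) ∷ []))

  -- In glue (x ∷ r) γ the first entry lies below the whole upper block, so it creates no
  -- descent; the remaining conditions split at the end of the upper block.
  descents-glue-upper : ∀ x r γ → OddDescentsᴸ (glue (x ∷ r) γ)
    ⇔ (OddDescentsᴸ (x ∷ r) × OddDescentsFrom (length γ ∷ init⁺ (x + suc (length γ)) (shift (suc (length γ)) r))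
                                                (last⁺ (x + suc (length γ)) (shift (suc (length γ)) r)) γ)
  descents-glue-upper x r γ = mk⇔
    (λ (_ , d) → let (d₁ , d₂) = to (descents-split [ c ] (x + k) (shift k r) γ) d
                 in to (descents-upper-block c x r) d₁ , d₂)
    (λ (d₁ , d₂) → (λ x+k<c → ⊥-elim (<-asym x+k<c (All.lookup (shift-above c (x ∷ r)) (here refl))))
                   , from (descents-split [ c ] (x + k) (shift k r) γ) (from (descents-upper-block c x r) d₁ , d₂))
    where
    c = length γ
    k = suc c

  glue-descents : ∀ {b} β γ → PermList b β → All (_< length γ) γ →
                  OddDescentsᴸ (glue β γ) ⇔ (OddDescentsᴸ β × OddDescentsᴸ γ × Junction β γ)
  glue-descents []      []       _ _         = mk⇔ (λ _ → tt , tt , tt) (λ _ → tt)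
  glue-descents []      (g ∷ gs) _ (g<c ∷ _) = mk⇔ (λ (first , _) → ⊥-elim (zero-even (first g<c))) (λ ())
    where zero-even : ¬ Odd 0
          zero-even ()
  glue-descents (x ∷ r) []       _ _         = mk⇔
    (λ d → proj₁ (to (descents-glue-upper x r []) d) , tt , tt)
    (λ (dβ , _ , _) → from (descents-glue-upper x r []) (dβ , tt))
  glue-descents (x ∷ r) (g ∷ gs) π γ<c       = mk⇔
    (λ d → let (dβ , d-rest) = to (descents-glue-upper x r (g ∷ gs)) d
               (j , dγ)      = to (descents-across-junction x r g gs π γ<c) d-rest
           in dβ , dγ , j)
    (λ (dβ , dγ , j) → from (descents-glue-upper x r (g ∷ gs))
                            (dβ , from (descents-across-junction x r g gs π γ<c) (j , dγ)))

-- Good permutations in list form: their characterization as admissible gluings.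
module GoodPermutations where

  open import Data.Nat using (ℕ; zero; suc; _+_; _<_; s≤s; parity; _%_)
  open import Data.Nat.Properties using (+-comm; +-identityʳ; m≤m+n; m≤n+m)
  open import Data.Nat.DivMod using ([m+n]%n≡m%n)
  open import Data.Nat.Induction using (<-rec)
  open import Data.Parity using (Parity; 0ℙ; 1ℙ; _⁻¹) renaming (_+_ to _+ᴾ_)
  open import Data.Parity.Properties using (+-homo-+; suc-homo-⁻¹; ⁻¹-selfInverse)
  open import Data.Bool using (true)
  open import Data.List using (List; []; _∷_; _++_; length)
  import Data.List.Properties as List
  open import Data.Product using (Σ; _,_)
  open import Data.Unit using (tt)
  open import Relation.Binary.PropositionalEquality using (_≡_; refl; sym; trans; cong; cong₂; subst; module ≡-Reasoning)
  open import Function using (_∘_)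
  open import Function.Bundles using (_⇔_; mk⇔; Equivalence)
  open Equivalence using (to; from)
  open Recurrence using (oddᵇ; admissible)
  open ListPermutations
  open Descents
  open ≡-Reasoning

  record Goodᴸ (n : ℕ) (ℓ : List ℕ) : Set where
    constructor good
    field
      isPerm   : PermList n ℓ
      avoids   : Avoids213ᴸ ℓ
      descents : OddDescentsᴸ ℓ

  good⇒glued : ∀ n ℓ → Goodᴸ (suc n) ℓ → Σ (Glued Goodᴸ n ℓ) λ s → Junction (Glued.β s) (Glued.γ s)
  good⇒glued n []         (good (perm _ _ ()) _ _)
  good⇒glued n (m ∷ rest) (good π (no213 , av) desc) with glue-split π no213
  ... | glued {β = β} {γ} sizes πβ πγ refl =
    let γ<c           = PermList.bounded (PermList-resize πγ)
        (avβ , avγ)   = to (glue-avoids β γ γ<c) (no213 , av)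
        (dβ , dγ , j) = to (glue-descents β γ πβ γ<c) desc
    in glued sizes (good πβ avβ dβ) (good πγ avγ dγ) refl , j

  glued⇒good : ∀ n ℓ → (Σ (Glued Goodᴸ n ℓ) λ s → Junction (Glued.β s) (Glued.γ s)) → Goodᴸ (suc n) ℓ
  glued⇒good n ℓ (glued {b} {c} {β} {γ} sizes (good πβ avβ dβ) (good πγ avγ dγ) refl , j) =
    good (subst (λ m → PermList (suc m) (glue β γ)) sizes (PermList-glue πβ πγ))
         (from (glue-avoids β γ γ<c) (avβ , avγ))
         (from (glue-descents β γ πβ γ<c) (dβ , dγ , j))
    where γ<c = PermList.bounded (PermList-resize πγ)

  %2-suc-suc : ∀ m → suc (suc m) % 2 ≡ m % 2
  %2-suc-suc m = trans (cong (_% 2) (+-comm 2 m)) ([m+n]%n≡m%n m 2)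

  odd⇒1ℙ : ∀ m → Odd m → parity m ≡ 1ℙ
  odd⇒1ℙ zero          ()
  odd⇒1ℙ (suc zero)    _ = refl
  odd⇒1ℙ (suc (suc m)) o = odd⇒1ℙ m (trans (sym (%2-suc-suc m)) o)

  1ℙ⇒odd : ∀ m → parity m ≡ 1ℙ → Odd m
  1ℙ⇒odd zero          ()
  1ℙ⇒odd (suc zero)    _ = refl
  1ℙ⇒odd (suc (suc m)) p = trans (%2-suc-suc m) (1ℙ⇒odd m p)

  parity-suc : ∀ n → parity (suc n) ≡ parity n ⁻¹
  parity-suc n = sym (⁻¹-selfInverse (suc-homo-⁻¹ n))

  parity-step : ∀ L b → parity (suc L) ≡ parity b → parity (suc (suc L)) ≡ parity (suc b)
  parity-step L b e = begin
    parity L          ≡⟨ sym (suc-homo-⁻¹ L) ⟩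
    parity (suc L) ⁻¹ ≡⟨ cong _⁻¹ e ⟩
    parity b ⁻¹       ≡⟨ sym (parity-suc b) ⟩
    parity (suc b)    ∎

  parity-odd-+ : ∀ b c → parity b ≡ 1ℙ → parity (suc (b + c)) ≡ parity c
  parity-odd-+ b c b-odd = begin
    parity (suc (b + c))          ≡⟨ +-homo-+ (suc b) c ⟩
    parity (suc b) +ᴾ parity c    ≡⟨ cong (λ p → p +ᴾ parity c) (trans (parity-suc b) (cong _⁻¹ b-odd)) ⟩
    parity c                      ∎

  -- The last entry of a list (0 for the empty list).
  lastEntry : List ℕ → ℕ
  lastEntry []      = 0
  lastEntry (y ∷ s) = last⁺ y s

  lastEntry-glue-right : ∀ β g gs → lastEntry (glue β (g ∷ gs)) ≡ last⁺ g gs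
  lastEntry-glue-right β g gs = last-of-++ (shift (suc (length (g ∷ gs))) β)
    where last-of-++ : ∀ {x} r → last⁺ x (r ++ g ∷ gs) ≡ last⁺ g gs
          last-of-++ []      = refl
          last-of-++ (z ∷ r) = last-of-++ r

  lastEntry-glue-left : ∀ y s → lastEntry (glue (y ∷ s) []) ≡ suc (last⁺ y s)
  lastEntry-glue-left y s = begin
    last⁺ (y + 1) (shift 1 s ++ [])  ≡⟨ cong (last⁺ (y + 1)) (List.++-identityʳ (shift 1 s)) ⟩
    last⁺ (y + 1) (shift 1 s)        ≡⟨ last⁺-map (_+ 1) y s ⟩
    last⁺ y s + 1                    ≡⟨ +-comm (last⁺ y s) 1 ⟩
    suc (last⁺ y s)                  ∎

  -- By strong induction along the gluing: the last entry comes from γ, or from β if γ is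
  -- empty, and a non-empty γ forces |β| odd through the junction condition.
  last-parity : ∀ n x r → Goodᴸ n (x ∷ r) → parity (suc (last⁺ x r)) ≡ parity n
  last-parity = <-rec _ step
    where
    step : ∀ n → (∀ {m} → m < n → ∀ x r → Goodᴸ m (x ∷ r) → parity (suc (last⁺ x r)) ≡ parity m) →
           ∀ x r → Goodᴸ n (x ∷ r) → parity (suc (last⁺ x r)) ≡ parity n
    step zero    ih x r (good (perm _ _ ()) _ _)
    step (suc n) ih x r g with good⇒glued n (x ∷ r) g
    ... | glued {b} {c} {β} {γ} refl gβ gγ shape , j =
      trans (cong (parity ∘ suc ∘ lastEntry) shape) (by-blocks β γ gβ gγ j)
      where
      ih-β : ∀ y s → Goodᴸ b (y ∷ s) → parity (suc (last⁺ y s)) ≡ parity b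
      ih-β = ih (s≤s (m≤m+n b c))
      ih-γ : ∀ y s → Goodᴸ c (y ∷ s) → parity (suc (last⁺ y s)) ≡ parity c
      ih-γ = ih (s≤s (m≤n+m c b))
      by-blocks : ∀ β γ → Goodᴸ b β → Goodᴸ c γ → Junction β γ →
                  parity (suc (lastEntry (glue β γ))) ≡ parity (suc (b + c))
      by-blocks []      []       (good (perm _ _ b≡0) _ _) (good (perm _ _ c≡0) _ _) _ =
        cong₂ (λ b′ c′ → parity (suc (b′ + c′))) b≡0 c≡0
      by-blocks (y ∷ s) []       gβ (good (perm _ _ c≡0) _ _) _ =
        trans (cong (parity ∘ suc) (lastEntry-glue-left y s))
              (trans (parity-step (last⁺ y s) b (ih-β y s gβ))
                     (cong (parity ∘ suc) (trans (sym (+-identityʳ b)) (cong (b +_) c≡0))))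
      by-blocks []      (g ∷ gs) _  _  ()
      by-blocks (y ∷ s) (g ∷ gs) gβ gγ j =
        trans (cong (parity ∘ suc) (lastEntry-glue-right (y ∷ s) g gs))
              (trans (ih-γ g gs gγ) (sym (parity-odd-+ b c (trans (sym (ih-β y s gβ)) (odd⇒1ℙ (suc (last⁺ y s)) j)))))

  oddᵇ⇔1ℙ : ∀ p → (oddᵇ p ≡ true) ⇔ (p ≡ 1ℙ)
  oddᵇ⇔1ℙ 0ℙ = mk⇔ (λ ()) (λ ())
  oddᵇ⇔1ℙ 1ℙ = mk⇔ (λ _ → refl) (λ _ → refl)

  -- By the parity invariant the junction condition only depends on the block sizes.
  junction⇔admissible : ∀ {b c β γ} → Goodᴸ b β → Goodᴸ c γ → Junction β γ ⇔ (admissible b c ≡ true)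
  junction⇔admissible {γ = []} _ (good (perm _ _ refl) _ _) = mk⇔ (λ _ → refl) (λ _ → tt)
  junction⇔admissible {β = []} {γ = _ ∷ _} (good (perm _ _ refl) _ _) (good (perm _ _ refl) _ _) = mk⇔ (λ ()) (λ ())
  junction⇔admissible {b} {β = y ∷ s} {γ = _ ∷ _} gβ (good (perm _ _ refl) _ _) = mk⇔
    (λ j → from (oddᵇ⇔1ℙ (parity b)) (trans (sym (last-parity b y s gβ)) (odd⇒1ℙ (suc (last⁺ y s)) j)))
    (λ adm → 1ℙ⇒odd (suc (last⁺ y s)) (trans (last-parity b y s gβ) (to (oddᵇ⇔1ℙ (parity b)) adm)))

  good-suc⇔ : ∀ n ℓ → Goodᴸ (suc n) ℓ ⇔ (Σ (Glued Goodᴸ n ℓ) λ s → admissible (Glued.b s) (Glued.c s) ≡ true)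
  good-suc⇔ n ℓ = mk⇔
    (λ g → let (s , j) = good⇒glued n ℓ g in s , to (junction⇔admissible (Glued.left s) (Glued.right s)) j)
    (λ (s , adm) → glued⇒good n ℓ (s , from (junction⇔admissible (Glued.left s) (Glued.right s)) adm))

module Counting where

  open import Data.Nat using (ℕ; zero; suc; _+_; _*_; s≤s)
  open import Data.Nat.Properties using (suc-injective; +-identityʳ; +-cancelʳ-≡; <-irrefl; ≤-trans; m≤n+m; ≤-reflexive)
  open import Data.Bool using (true; false; if_then_else_)
  open import Data.List using (List; []; _∷_; _++_; map; length; concatMap; cartesianProductWith)
  import Data.List.Properties as List
  open import Data.List.Relation.Unary.All as All using (All; []; _∷_)
  open import Data.List.Relation.Unary.Any using (here; there)
  open import Data.List.Relation.Unary.AllPairs using ([]; _∷_)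
  open import Data.List.Relation.Unary.Unique.Propositional using (Unique)
  import Data.List.Relation.Unary.Unique.Propositional.Properties as Unique
  open import Data.List.Membership.Propositional using (_∈_; lose; find)
  import Data.List.Membership.Propositional.Properties as ∈
  open import Data.List.Membership.Propositional.Properties.WithK using (unique∧set⇒bag)
  open import Data.List.Relation.Binary.BagAndSetEquality using (∼bag⇒↭)
  open import Data.List.Relation.Binary.Permutation.Propositional.Properties using (↭-length)
  open import Data.Product using (Σ; _×_; _,_; proj₂)
  import Data.Product as Product
  open import Relation.Nullary using (¬_)
  open import Relation.Binary.PropositionalEquality using (_≡_; _≢_; refl; sym; trans; cong; cong₂; subst; module ≡-Reasoning)
  open import Function using (_∘_)
  open import Function.Bundles using (_⇔_; mk⇔; Equivalence)
  open Equivalence using (to; from)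
  open Series using (convolve; convolve-cong)
  open Recurrence using (admissible; weight)
  open ListPermutations using (glue; shift; Glued; glued; PermList)
  open GoodPermutations

  same-members⇒same-length : ∀ {A : Set} {xs ys : List A} → Unique xs → Unique ys →
                             (∀ {z} → (z ∈ xs) ⇔ (z ∈ ys)) → length xs ≡ length ys
  same-members⇒same-length uxs uys same = ↭-length (∼bag⇒↭ (unique∧set⇒bag uxs uys same))

  concatMap-unique : ∀ {A B C : Set} (tag : A → C) (key : B → C) (f : A → List B) xs →
                     Unique (map tag xs) → (∀ {x} → x ∈ xs → Unique (f x)) →
                     (∀ {x y} → x ∈ xs → y ∈ f x → key y ≡ tag x) → Unique (concatMap f xs)
  concatMap-unique tag key f []       _              _      _      = []
  concatMap-unique tag key f (x ∷ xs) (x-fresh ∷ u) unique keyed =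
    Unique.++⁺ (unique (here refl)) (concatMap-unique tag key f xs u (unique ∘ there) (keyed ∘ there)) disjoint
    where
    disjoint : ∀ {v} → ¬ (v ∈ f x × v ∈ concatMap f xs)
    disjoint (v∈fx , v∈rest) with find (∈.∈-concatMap⁻ f {xs = xs} v∈rest)
    ... | x′ , x′∈xs , v∈fx′ =
      All.lookup x-fresh (∈.∈-map⁺ tag x′∈xs) (trans (sym (keyed (here refl) v∈fx)) (keyed (there x′∈xs) v∈fx′))

  length-cartesianProductWith : ∀ {A B C : Set} (f : A → B → C) xs ys →
                                length (cartesianProductWith f xs ys) ≡ length xs * length ys
  length-cartesianProductWith f []       ys = refl
  length-cartesianProductWith f (x ∷ xs) ys =
    trans (List.length-++ (map (f x) ys)) (cong₂ _+_ (List.length-map (f x) ys) (length-cartesianProductWith f xs ys))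

  -- The pairs (b, c) with b + c = n, in the order in which convolve visits them.
  splits : ℕ → List (ℕ × ℕ)
  splits zero    = (0 , 0) ∷ []
  splits (suc n) = (0 , suc n) ∷ map (Product.map₁ suc) (splits n)

  length-concatMap-splits : ∀ {B : Set} (f : ℕ × ℕ → List B) n →
                            length (concatMap f (splits n)) ≡ convolve (λ b c → length (f (b , c))) n
  length-concatMap-splits f zero    = cong length (List.++-identityʳ (f (0 , 0)))
  length-concatMap-splits f (suc n) =
    trans (List.length-++ (f (0 , suc n)))
          (cong (length (f (0 , suc n)) +_)
                (trans (cong length (List.concatMap-map f (Product.map₁ suc) (splits n)))
                       (length-concatMap-splits (f ∘ Product.map₁ suc) n)))

  ∈-splits⁻ : ∀ n {b c} → (b , c) ∈ splits n → b + c ≡ n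
  ∈-splits⁻ zero    (here refl) = refl
  ∈-splits⁻ (suc n) (here refl) = refl
  ∈-splits⁻ (suc n) (there bc∈) with ∈.∈-map⁻ (Product.map₁ suc) bc∈
  ... | (b , c) , bc∈′ , refl = cong suc (∈-splits⁻ n bc∈′)

  ∈-splits⁺ : ∀ n b c → b + c ≡ n → (b , c) ∈ splits n
  ∈-splits⁺ zero    zero    zero    refl = here refl
  ∈-splits⁺ (suc n) zero    .(suc n) refl = here refl
  ∈-splits⁺ (suc n) (suc b) c       e    = there (∈.∈-map⁺ (Product.map₁ suc) (∈-splits⁺ n b c (suc-injective e)))

  splits-unique : ∀ n → Unique (map proj₂ (splits n))
  splits-unique zero    = [] ∷ []
  splits-unique (suc n) = subst (λ cs → Unique (suc n ∷ cs)) (List.map-∘ (splits n))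
                                (All.tabulate fresh ∷ splits-unique n)
    where
    fresh : ∀ {c} → c ∈ map proj₂ (splits n) → suc n ≢ c
    fresh c∈ refl with ∈.∈-map⁻ proj₂ c∈
    ... | (b , c) , bc∈ , refl = <-irrefl refl (≤-trans (s≤s (m≤n+m c b)) (≤-reflexive (cong suc (∈-splits⁻ n bc∈))))

  ++-injective : ∀ {A : Set} {xs ys zs ws : List A} → length xs ≡ length ys → xs ++ zs ≡ ys ++ ws → xs ≡ ys × zs ≡ ws
  ++-injective {xs = []}     {[]}     _ e = refl , e
  ++-injective {xs = x ∷ xs} {y ∷ ys} l e with List.∷-injective e
  ... | refl , e′ = Product.map₁ (cong (x ∷_)) (++-injective (suc-injective l) e′)

  -- Gluing is injective: the head fixes |γ|, hence the split of the tail.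
  glue-injective : ∀ {β β′ γ γ′} → glue β γ ≡ glue β′ γ′ → β ≡ β′ × γ ≡ γ′
  glue-injective {β} {β′} {γ} {γ′} e =
    Product.map₁ (List.map-injective (+-cancelʳ-≡ k _ _)) (++-injective same-prefix tails)
    where
    k = suc (length γ′)
    c≡c′ = List.∷-injectiveˡ e
    tails : shift k β ++ γ ≡ shift k β′ ++ γ′
    tails = trans (cong (λ m → shift (suc m) β ++ γ) (sym c≡c′)) (List.∷-injectiveʳ e)
    same-prefix : length (shift k β) ≡ length (shift k β′)
    same-prefix = +-cancelʳ-≡ (length γ′) _ _ (begin
      length (shift k β) + length γ′   ≡⟨ cong (length (shift k β) +_) (sym c≡c′) ⟩
      length (shift k β) + length γ    ≡⟨ sym (List.length-++ (shift k β)) ⟩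
      length (shift k β ++ γ)          ≡⟨ cong length tails ⟩
      length (shift k β′ ++ γ′)        ≡⟨ List.length-++ (shift k β′) ⟩
      length (shift k β′) + length γ′  ∎)
      where open ≡-Reasoning

  module _ {A : Set} where

    ∈-if⁻ : ∀ t {xs : List A} {z} → z ∈ (if t then xs else []) → t ≡ true × z ∈ xs
    ∈-if⁻ true  z∈ = refl , z∈

    ∈-if⁺ : ∀ {t} {xs : List A} {z} → t ≡ true → z ∈ xs → z ∈ (if t then xs else [])
    ∈-if⁺ refl z∈ = z∈

    unique-if : ∀ t {xs : List A} → Unique xs → Unique (if t then xs else [])
    unique-if true  u = u
    unique-if false _ = []

    length-if : ∀ t (xs : List A) → length (if t then xs else []) ≡ (if t then 1 else 0) * length xs
    length-if true  xs = sym (+-identityʳ (length xs))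
    length-if false xs = refl

  -- The first entry of a gluing identifies the size of its second block.
  firstEntry : List ℕ → ℕ
  firstEntry []      = 0
  firstEntry (x ∷ _) = x

  -- Counting through any duplicate-free enumeration S n of the good permutations of [n]:
  -- S (n+1) has the same members as the list of all admissible gluings, which is
  -- duplicate-free, so the two have the same length.
  module Count (S : ℕ → List (List ℕ)) (S-unique : ∀ n → Unique (S n))
               (S-members : ∀ n ℓ → (ℓ ∈ S n) ⇔ Goodᴸ n ℓ) where

    block : ℕ × ℕ → List (List ℕ)
    block (b , c) = if admissible b c then cartesianProductWith glue (S b) (S c) else []

    gluings : ℕ → List (List ℕ)
    gluings n = concatMap block (splits n)

    length-gluings : ∀ n → length (gluings n) ≡ convolve (λ b c → weight b c * (length (S b) * length (S c))) n
    length-gluings n = trans (length-concatMap-splits block n) (convolve-cong _ _ n (λ b c _ →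
      trans (length-if (admissible b c) (cartesianProductWith glue (S b) (S c)))
            (cong (weight b c *_) (length-cartesianProductWith glue (S b) (S c)))))

    block-key : ∀ {bc ℓ} → ℓ ∈ block bc → firstEntry ℓ ≡ proj₂ bc
    block-key {b , c} ℓ∈ with ∈.∈-cartesianProductWith⁻ glue (S b) (S c) (proj₂ (∈-if⁻ (admissible b c) ℓ∈))
    ... | β , γ , _ , γ∈ , refl = PermList.size (Goodᴸ.isPerm (to (S-members c γ) γ∈))

    -- Distinct splits give disjoint blocks, and gluing is injective within a block.
    gluings-unique : ∀ n → Unique (gluings n)
    gluings-unique n = concatMap-unique proj₂ firstEntry block (splits n) (splits-unique n)
      (λ {(b , c)} _ → unique-if (admissible b c) (Unique.cartesianProductWith⁺ glue glue-injective (S-unique b) (S-unique c)))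
      (λ _ → block-key)

    ∈-gluings⁻ : ∀ n ℓ → ℓ ∈ gluings n → Σ (Glued Goodᴸ n ℓ) λ s → admissible (Glued.b s) (Glued.c s) ≡ true
    ∈-gluings⁻ n ℓ ℓ∈ with find (∈.∈-concatMap⁻ block {xs = splits n} ℓ∈)
    ... | (b , c) , bc∈ , ℓ∈block with ∈-if⁻ (admissible b c) ℓ∈block
    ... | adm , ℓ∈product with ∈.∈-cartesianProductWith⁻ glue (S b) (S c) ℓ∈product
    ... | β , γ , β∈ , γ∈ , shape =
      glued (∈-splits⁻ n bc∈) (to (S-members b β) β∈) (to (S-members c γ) γ∈) shape , adm

    ∈-gluings⁺ : ∀ n ℓ → (Σ (Glued Goodᴸ n ℓ) λ s → admissible (Glued.b s) (Glued.c s) ≡ true) → ℓ ∈ gluings n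
    ∈-gluings⁺ n ℓ (glued {b} {c} {β} {γ} sizes gβ gγ refl , adm) =
      ∈.∈-concatMap⁺ block {xs = splits n}
        (lose (∈-splits⁺ n b c sizes)
              (∈-if⁺ adm (∈.∈-cartesianProductWith⁺ glue (from (S-members b β) gβ) (from (S-members c γ) gγ))))

    count : ∀ n → length (S (suc n)) ≡ convolve (λ b c → weight b c * (length (S b) * length (S c))) n
    count n = trans (same-members⇒same-length (S-unique (suc n)) (gluings-unique n) (λ {ℓ} → mk⇔
                       (∈-gluings⁺ n ℓ ∘ to (good-suc⇔ n ℓ) ∘ to (S-members (suc n) ℓ))
                       (from (S-members (suc n) ℓ) ∘ from (good-suc⇔ n ℓ) ∘ ∈-gluings⁻ n ℓ)))
                    (length-gluings n)

module Words where

  open import Data.Nat using (ℕ; zero; suc; _+_; _<_; z≤n; s≤s)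
  open import Data.Nat.Properties using (suc-injective; ≤-pred; +-identityʳ; +-assoc)
  open import Data.Fin using (Fin; toℕ; fromℕ<) renaming (zero to fzero; suc to fsuc; _<_ to _<ᶠ_)
  open import Data.Fin.Properties using (toℕ-injective; toℕ<n; toℕ-fromℕ<) renaming (_<?_ to _<ᶠ?_; suc-injective to fsuc-injective)
  open import Data.Vec using (Vec; lookup; []; _∷_)
  import Data.Vec.Properties as Vec
  open import Data.List using (List; []; _∷_; _++_; [_]; _∷ʳ_; map; filter; length; allFin)
  import Data.List.Properties as List
  open import Data.List.Relation.Unary.All as All using (All; []; _∷_)
  open import Data.List.Relation.Unary.Any using (here)
  open import Data.List.Relation.Unary.AllPairs using ([]; _∷_)
  open import Data.List.Relation.Unary.Unique.Propositional using (Unique)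
  import Data.List.Relation.Unary.Unique.Propositional.Properties as Unique
  open import Data.List.Membership.Propositional using (_∈_; lose)
  import Data.List.Membership.Propositional.Properties as ∈
  open import Data.Product using (Σ; _×_; _,_; proj₁; proj₂)
  open import Data.Unit using (tt)
  open import Data.Empty using (⊥-elim)
  open import Relation.Nullary using (¬_; Dec; yes; no)
  open import Relation.Nullary.Decidable using (_×-dec_)
  open import Relation.Binary.PropositionalEquality using (_≡_; _≢_; refl; sym; trans; cong; cong₂; subst; module ≡-Reasoning)
  open import Function using (_∘_; id)
  open import Function.Bundles using (_⇔_; mk⇔; Equivalence)
  open Equivalence using (to; from)
  open ListPermutations using (perm; NoBelowThenAbove; Avoids213ᴸ)
  open Descents using (filter-map; countBetween; between?; countBetween-++; OddDescentsFrom; OddDescentsᴸ)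
  open GoodPermutations using (Goodᴸ; good)
  open Counting using (concatMap-unique)

  entries : ∀ {m l} → Vec (Fin m) l → List ℕ
  entries []       = []
  entries (x ∷ xs) = toℕ x ∷ entries xs

  entries-injective : ∀ {m l} {v w : Vec (Fin m) l} → entries v ≡ entries w → v ≡ w
  entries-injective {v = []}    {[]}    _ = refl
  entries-injective {v = x ∷ v} {y ∷ w} e =
    cong₂ _∷_ (toℕ-injective (List.∷-injectiveˡ e)) (entries-injective (List.∷-injectiveʳ e))

  length-entries : ∀ {m l} (v : Vec (Fin m) l) → length (entries v) ≡ l
  length-entries []      = refl
  length-entries (x ∷ v) = cong suc (length-entries v)

  entries-bounded : ∀ {m l} (v : Vec (Fin m) l) → All (_< m) (entries v)
  entries-bounded []      = []
  entries-bounded (x ∷ v) = toℕ<n x ∷ entries-bounded v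

  All-entries : ∀ {m l} {P : ℕ → Set} (v : Vec (Fin m) l) → All P (entries v) ⇔ (∀ j → P (toℕ (lookup v j)))
  All-entries []      = mk⇔ (λ _ ()) (λ _ → [])
  All-entries (x ∷ v) = mk⇔
    (λ { (p ∷ ps) fzero → p ; (p ∷ ps) (fsuc j) → to (All-entries v) ps j })
    (λ f → f fzero ∷ from (All-entries v) (f ∘ fsuc))

  entries-surjective : ∀ {m n} (ℓ : List ℕ) → All (_< m) ℓ → length ℓ ≡ n → Σ (Vec (Fin m) n) λ w → entries w ≡ ℓ
  entries-surjective []      _          refl = [] , refl
  entries-surjective (x ∷ ℓ) (x<m ∷ ℓ<m) refl =
    let (w , e) = entries-surjective ℓ ℓ<m refl in fromℕ< x<m ∷ w , cong₂ _∷_ (toℕ-fromℕ< x<m) e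

  words-complete : ∀ n m (w : Vec (Fin n) m) → w ∈ words n m
  words-complete n zero    []      = here refl
  words-complete n (suc m) (a ∷ w) =
    ∈.∈-concatMap⁺ (λ a → map (a ∷_) (words n m)) {xs = allFin n}
      (lose (∈.∈-allFin a) (∈.∈-map⁺ (a ∷_) (words-complete n m w)))

  words-unique : ∀ n m → Unique (words n m)
  words-unique n zero    = [] ∷ []
  words-unique n (suc m) =
    concatMap-unique id headᵛ (λ a → map (a ∷_) (words n m)) (allFin n)
      (subst Unique (sym (List.map-id (allFin n))) (Unique.allFin⁺ n))
      (λ _ → Unique.map⁺ (λ e → proj₂ (Vec.∷-injective e)) (words-unique n m))
      (λ _ w∈ → head-of w∈)
    where
    headᵛ : Vec (Fin n) (suc m) → Fin n
    headᵛ (a ∷ _) = a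
    head-of : ∀ {a w} → w ∈ map (a ∷_) (words n m) → headᵛ w ≡ a
    head-of w∈ with ∈.∈-map⁻ _ w∈
    ... | _ , _ , refl = refl

  -- The conditions of Defs for words of arbitrary length l over Fin m; at l = m = n
  -- they are literally IsPerm, Avoids213 and between.
  IsPermᵛ : ∀ {m l} → Vec (Fin m) l → Set
  IsPermᵛ {m} {l} π = ∀ (i j : Fin l) → lookup π i ≡ lookup π j → i ≡ j

  Avoids213ᵛ : ∀ {m l} → Vec (Fin m) l → Set
  Avoids213ᵛ {m} {l} π = ∀ (i j k : Fin l) → i <ᶠ j → j <ᶠ k →
    ¬ (lookup π j <ᶠ lookup π i × lookup π i <ᶠ lookup π k)

  betweenᵛ : ∀ {m l} → Vec (Fin m) l → Fin l → Fin l → List (Fin l)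
  betweenᵛ π i i′ =
    filter (λ j → j <ᶠ? i)
      (filter (λ j → lookup π i′ <ᶠ? lookup π j)
        (filter (λ j → lookup π j <ᶠ? lookup π i) (allFin _)))

  unique⇒injective : ∀ {m l} (π : Vec (Fin m) l) → Unique (entries π) → IsPermᵛ π
  unique⇒injective (x ∷ π) (x∉ ∷ u) fzero    fzero    e = refl
  unique⇒injective (x ∷ π) (x∉ ∷ u) fzero    (fsuc j) e = ⊥-elim (to (All-entries π) x∉ j (cong toℕ e))
  unique⇒injective (x ∷ π) (x∉ ∷ u) (fsuc i) fzero    e = ⊥-elim (to (All-entries π) x∉ i (cong toℕ (sym e)))
  unique⇒injective (x ∷ π) (x∉ ∷ u) (fsuc i) (fsuc j) e = cong fsuc (unique⇒injective π u i j e)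

  injective⇒unique : ∀ {m l} (π : Vec (Fin m) l) → IsPermᵛ π → Unique (entries π)
  injective⇒unique []      _   = []
  injective⇒unique (x ∷ π) inj =
    from (All-entries π) (λ j e → zero≢suc (inj fzero (fsuc j) (toℕ-injective e)))
    ∷ injective⇒unique π (λ i j e → fsuc-injective (inj (fsuc i) (fsuc j) e))
    where zero≢suc : ∀ {l} {j : Fin l} → fzero ≢ fsuc j
          zero≢suc ()

  noBelowThenAbove⇔ : ∀ {m l} (x : Fin m) (π : Vec (Fin m) l) →
    (∀ (j k : Fin l) → j <ᶠ k → ¬ (lookup π j <ᶠ x × x <ᶠ lookup π k)) ⇔ NoBelowThenAbove (toℕ x) (entries π)
  noBelowThenAbove⇔ x []      = mk⇔ (λ _ → tt) (λ _ ())
  noBelowThenAbove⇔ x (y ∷ π) = mk⇔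
    (λ h → (λ y<x → from (All-entries π) (λ k x<k → h fzero (fsuc k) (s≤s z≤n) (y<x , x<k)))
           , to (noBelowThenAbove⇔ x π) (λ j k j<k → h (fsuc j) (fsuc k) (s≤s j<k)))
    (λ (after , rest) → λ where
      fzero    fzero    ()
      (fsuc j) fzero    ()
      fzero    (fsuc k) _         (y<x , x<k) → to (All-entries π) (after y<x) k x<k
      (fsuc j) (fsuc k) (s≤s j<k)             → from (noBelowThenAbove⇔ x π) rest j k j<k)

  avoids213⇔ : ∀ {m l} (π : Vec (Fin m) l) → Avoids213ᵛ π ⇔ Avoids213ᴸ (entries π)
  avoids213⇔ []      = mk⇔ (λ _ → tt) (λ _ ())
  avoids213⇔ (x ∷ π) = mk⇔
    (λ h → to (noBelowThenAbove⇔ x π) (λ j k j<k → h fzero (fsuc j) (fsuc k) (s≤s z≤n) (s≤s j<k))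
         , to (avoids213⇔ π) (λ i j k i<j j<k → h (fsuc i) (fsuc j) (fsuc k) (s≤s i<j) (s≤s j<k)))
    (λ (nx , av) → λ where
      fzero    fzero    _        ()        _
      fzero    (fsuc j) fzero    _         ()
      fzero    (fsuc j) (fsuc k) _         (s≤s j<k)              → from (noBelowThenAbove⇔ x π) nx j k j<k
      (fsuc i) fzero    _        ()        _
      (fsuc i) (fsuc j) fzero    _         ()
      (fsuc i) (fsuc j) (fsuc k) (s≤s i<j) (s≤s j<k)              → from (avoids213⇔ π) av i j k i<j j<k)

  filter-filter : ∀ {A : Set} {P Q : A → Set} (P? : ∀ x → Dec (P x)) (Q? : ∀ x → Dec (Q x)) xs →
                  filter P? (filter Q? xs) ≡ filter (λ x → Q? x ×-dec P? x) xs
  filter-filter P? Q? []       = refl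
  filter-filter {P = P} {Q} P? Q? (x ∷ xs) = by-cases (Q? x) (P? x)
    where
    C? = λ x → Q? x ×-dec P? x
    ih = filter-filter P? Q? xs
    by-cases : Dec (Q x) → Dec (P x) → filter P? (filter Q? (x ∷ xs)) ≡ filter C? (x ∷ xs)
    by-cases (no ¬q) _ =
      trans (cong (filter P?) (List.filter-reject Q? ¬q)) (trans ih (sym (List.filter-reject C? (¬q ∘ proj₁))))
    by-cases (yes q) (yes p) =
      trans (cong (filter P?) (List.filter-accept Q? q))
            (trans (List.filter-accept P? p) (trans (cong (x ∷_) ih) (sym (List.filter-accept C? (q , p)))))
    by-cases (yes q) (no ¬p) =
      trans (cong (filter P?) (List.filter-accept Q? q))
            (trans (List.filter-reject P? ¬p) (trans ih (sym (List.filter-reject C? (¬p ∘ proj₂)))))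

  length-filter-[] : ∀ {A B : Set} {P : A → Set} {Q : B → Set} (P? : ∀ x → Dec (P x)) (Q? : ∀ x → Dec (Q x)) {v w} →
                     P v ⇔ Q w → length (filter P? [ v ]) ≡ length (filter Q? [ w ])
  length-filter-[] P? Q? {v} {w} P⇔Q with P? v | Q? w
  ... | yes _  | yes _  = refl
  ... | no  _  | no  _  = refl
  ... | yes p  | no ¬q  = ⊥-elim (¬q (to P⇔Q p))
  ... | no ¬p  | yes q  = ⊥-elim (¬p (from P⇔Q q))

  InBetween : ∀ {m l} → Vec (Fin m) l → Fin l → Fin l → Fin l → Set
  InBetween π i i′ j = (lookup π j <ᶠ lookup π i × lookup π i′ <ᶠ lookup π j) × j <ᶠ i

  inBetween? : ∀ {m l} (π : Vec (Fin m) l) i i′ j → Dec (InBetween π i i′ j)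
  inBetween? π i i′ j = ((lookup π j <ᶠ? lookup π i) ×-dec (lookup π i′ <ᶠ? lookup π j)) ×-dec (j <ᶠ? i)

  betweenᵛ≡ : ∀ {m l} (π : Vec (Fin m) l) i i′ → betweenᵛ π i i′ ≡ filter (inBetween? π i i′) (allFin l)
  betweenᵛ≡ π i i′ =
    trans (cong (filter (λ j → j <ᶠ? i)) (filter-filter (λ j → lookup π i′ <ᶠ? lookup π j) (λ j → lookup π j <ᶠ? lookup π i) (allFin _)))
          (filter-filter (λ j → j <ᶠ? i) (λ j → (lookup π j <ᶠ? lookup π i) ×-dec (lookup π i′ <ᶠ? lookup π j)) (allFin _))

  betweenᵛ-first : ∀ {m l} (π : Vec (Fin m) (suc l)) i′ → length (betweenᵛ π fzero i′) ≡ 0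
  betweenᵛ-first {l = l} π i′ = cong length (List.filter-none (λ j → j <ᶠ? fzero {l}) (All.universal nothing-before-first candidates))
    where
    nothing-before-first : (j : Fin (suc l)) → ¬ (j <ᶠ fzero {l})
    nothing-before-first j ()
    candidates = filter (λ j → lookup π i′ <ᶠ? lookup π j) (filter (λ j → lookup π j <ᶠ? lookup π fzero) (allFin (suc l)))

  betweenᵛ-∷ : ∀ {m l} (x : Fin m) (xs : Vec (Fin m) l) i i′ →
               length (betweenᵛ (x ∷ xs) (fsuc i) (fsuc i′))
               ≡ countBetween (toℕ (lookup xs i′)) (toℕ (lookup xs i)) [ toℕ x ] + length (betweenᵛ xs i i′)
  betweenᵛ-∷ {l = l} x xs i i′ = begin
    length (betweenᵛ π (fsuc i) (fsuc i′))
      ≡⟨ cong length (betweenᵛ≡ π (fsuc i) (fsuc i′)) ⟩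
    length (filter B (allFin (suc l)))
      ≡⟨ cong (length ∘ filter B ∘ (fzero ∷_)) (sym (List.map-tabulate id fsuc)) ⟩
    length (filter B (fzero ∷ map fsuc (allFin l)))
      ≡⟨ cong length (List.filter-++ B [ fzero ] (map fsuc (allFin l))) ⟩
    length (filter B [ fzero ] ++ filter B (map fsuc (allFin l)))
      ≡⟨ List.length-++ (filter B [ fzero ]) ⟩
    length (filter B [ fzero ]) + length (filter B (map fsuc (allFin l)))
      ≡⟨ cong₂ _+_ first later ⟩
    countBetween (toℕ (lookup xs i′)) (toℕ (lookup xs i)) [ toℕ x ] + length (betweenᵛ xs i i′)
      ∎
    where
    open ≡-Reasoning
    π = x ∷ xs
    B = inBetween? π (fsuc i) (fsuc i′)
    first : length (filter B [ fzero ]) ≡ countBetween (toℕ (lookup xs i′)) (toℕ (lookup xs i)) [ toℕ x ]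
    first = length-filter-[] B (between? _ _) (mk⇔ (λ ((x<a , b<x) , _) → b<x , x<a) (λ (b<x , x<a) → (x<a , b<x) , s≤s z≤n))
    later : length (filter B (map fsuc (allFin l))) ≡ length (betweenᵛ xs i i′)
    later = begin
      length (filter B (map fsuc (allFin l)))               ≡⟨ cong length (filter-map B fsuc (allFin l)) ⟩
      length (map fsuc (filter (B ∘ fsuc) (allFin l)))      ≡⟨ List.length-map fsuc (filter (B ∘ fsuc) (allFin l)) ⟩
      length (filter (B ∘ fsuc) (allFin l))                 ≡⟨ cong length (List.filter-≐ (B ∘ fsuc) (inBetween? xs i i′)
                                                                 ((λ (o , lt) → o , ≤-pred lt) , (λ (o , j<i) → o , s≤s j<i)) (allFin l)) ⟩
      length (filter (inBetween? xs i i′) (allFin l))       ≡⟨ cong length (sym (betweenᵛ≡ xs i i′)) ⟩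
      length (betweenᵛ xs i i′)                             ∎

  -- AvoidsBar2o31 for a word standing after the entries pre, which count as earlier entries.
  OddDescentsAfter : ∀ {m l} → List ℕ → Vec (Fin m) l → Set
  OddDescentsAfter {l = l} pre π = ∀ (i i′ : Fin l) → suc (toℕ i) ≡ toℕ i′ → lookup π i′ <ᶠ lookup π i →
    Odd (countBetween (toℕ (lookup π i′)) (toℕ (lookup π i)) pre + length (betweenᵛ π i i′))

  count-shift : ∀ {m l} pre (x : Fin m) (xs : Vec (Fin m) l) i i′ →
    countBetween (toℕ (lookup xs i′)) (toℕ (lookup xs i)) pre + length (betweenᵛ (x ∷ xs) (fsuc i) (fsuc i′))
    ≡ countBetween (toℕ (lookup xs i′)) (toℕ (lookup xs i)) (pre ∷ʳ toℕ x) + length (betweenᵛ xs i i′)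
  count-shift pre x xs i i′ = begin
    cb pre + length (betweenᵛ (x ∷ xs) (fsuc i) (fsuc i′))  ≡⟨ cong (cb pre +_) (betweenᵛ-∷ x xs i i′) ⟩
    cb pre + (cb [ toℕ x ] + length (betweenᵛ xs i i′))     ≡⟨ sym (+-assoc (cb pre) _ _) ⟩
    (cb pre + cb [ toℕ x ]) + length (betweenᵛ xs i i′)     ≡⟨ cong (_+ length (betweenᵛ xs i i′)) (sym (countBetween-++ _ _ pre [ toℕ x ])) ⟩
    cb (pre ∷ʳ toℕ x) + length (betweenᵛ xs i i′)            ∎
    where
    open ≡-Reasoning
    cb = countBetween (toℕ (lookup xs i′)) (toℕ (lookup xs i))

  count-first : ∀ {m l} pre (x y : Fin m) (ys : Vec (Fin m) l) →
    countBetween (toℕ y) (toℕ x) pre + length (betweenᵛ (x ∷ y ∷ ys) fzero (fsuc fzero)) ≡ countBetween (toℕ y) (toℕ x) pre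
  count-first pre x y ys = trans (cong (countBetween (toℕ y) (toℕ x) pre +_) (betweenᵛ-first (x ∷ y ∷ ys) (fsuc fzero))) (+-identityʳ _)

  descents-after⇔ : ∀ {m l} pre (x : Fin m) (xs : Vec (Fin m) l) →
                    OddDescentsAfter pre (x ∷ xs) ⇔ OddDescentsFrom pre (toℕ x) (entries xs)
  descents-after⇔ pre x []       = mk⇔ (λ _ → tt) (λ _ → λ where fzero fzero ())
  descents-after⇔ pre x (y ∷ ys) = mk⇔
    (λ h → (λ y<x → subst Odd (count-first pre x y ys) (h fzero (fsuc fzero) refl y<x))
         , to (descents-after⇔ (pre ∷ʳ toℕ x) y ys)
              (λ i i′ e lt → subst Odd (count-shift pre x (y ∷ ys) i i′) (h (fsuc i) (fsuc i′) (cong suc e) lt)))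
    (λ (first , later) → λ where
      fzero    fzero           ()
      fzero    (fsuc fzero)    _  y<x → subst Odd (sym (count-first pre x y ys)) (first y<x)
      fzero    (fsuc (fsuc _)) ()
      (fsuc i) fzero           ()
      (fsuc i) (fsuc i′)       e  lt  → subst Odd (sym (count-shift pre x (y ∷ ys) i i′))
                                          (from (descents-after⇔ (pre ∷ʳ toℕ x) y ys) later i i′ (suc-injective e) lt))

  avoidsBar⇔ : ∀ {n} (π : Vec (Fin n) n) → AvoidsBar2o31 π ⇔ OddDescentsᴸ (entries π)
  avoidsBar⇔ []      = mk⇔ (λ _ → tt) (λ _ ())
  avoidsBar⇔ (x ∷ π) = descents-after⇔ [] x π

  good⇔ : ∀ {n} (w : Vec (Fin n) n) → Good w ⇔ Goodᴸ n (entries w)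
  good⇔ w = mk⇔
    (λ (inj , av , bar) → good (perm (injective⇒unique w inj) (entries-bounded w) (length-entries w))
                               (to (avoids213⇔ w) av) (to (avoidsBar⇔ w) bar))
    (λ (good (perm u _ _) av bar) → unique⇒injective w u , from (avoids213⇔ w) av , from (avoidsBar⇔ w) bar)

  goodLists : ℕ → List (List ℕ)
  goodLists n = map entries (filter good? (words n n))

  goodLists-unique : ∀ n → Unique (goodLists n)
  goodLists-unique n = Unique.map⁺ entries-injective (Unique.filter⁺ good? (words-unique n n))

  ∈-goodLists⇔ : ∀ n ℓ → (ℓ ∈ goodLists n) ⇔ Goodᴸ n ℓ
  ∈-goodLists⇔ n ℓ = mk⇔
    (λ ℓ∈ → let (w , w∈ , ℓ≡) = ∈.∈-map⁻ entries ℓ∈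
            in subst (Goodᴸ n) (sym ℓ≡) (to (good⇔ w) (proj₂ (∈.∈-filter⁻ good? {xs = words n n} w∈))))
    (λ g@(good (perm _ bounded size) _ _) →
       let (w , w≡) = entries-surjective ℓ bounded size
       in subst (_∈ goodLists n) w≡
            (∈.∈-map⁺ entries (∈.∈-filter⁺ good? (words-complete n n w) (from (good⇔ w) (subst (Goodᴸ n) (sym w≡) g)))))

  length-goodLists : ∀ n → length (goodLists n) ≡ d n
  length-goodLists n = List.length-map entries (filter good? (words n n))

open Series using (convolve; convolve-cong; T₁≡quotient; T₂≡quotient)
open Recurrence using (weight; module BlockRecurrence)
open Counting using (module Count)
open Words using (goodLists; goodLists-unique; ∈-goodLists⇔; length-goodLists)

open Count goodLists goodLists-unique ∈-goodLists⇔ using (count)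

d-zero : d 0 ≡ 1
d-zero = refl

d-suc : ∀ n → d (suc n) ≡ convolve (λ b c → weight b c * (d b * d c)) n
d-suc n = begin
  d (suc n)                                                                        ≡⟨ sym (length-goodLists (suc n)) ⟩
  length (goodLists (suc n))                                                       ≡⟨ count n ⟩
  convolve (λ b c → weight b c * (length (goodLists b) * length (goodLists c))) n ≡⟨ convolve-cong _ _ n (λ b c _ →
                                                                                        cong₂ (λ x y → weight b c * (x * y)) (length-goodLists b) (length-goodLists c)) ⟩
  convolve (λ b c → weight b c * (d b * d c)) n                                    ∎
  where open ≡-Reasoning

open BlockRecurrence d d-zero d-suc using (even-terms; odd-terms)

-- The main theorem.
proposition2p2 : ∀ (n k : ℕ) → n ≥ 1 →
    (n ≡ 2 * k → d n ≡ ((3 * k) C k) / suc (2 * k))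
    × (n ≡ 2 * k + 1 → d n ≡ ((3 * k + 1) C (k + 1)) / suc (2 * k))
proposition2p2 n k _ =
  (λ n≡2k   → trans (cong d n≡2k) (trans (even-terms k) (sym (T₁≡quotient k))))
  , (λ n≡2k+1 → trans (cong d n≡2k+1) (trans (odd-terms k) (sym (T₂≡quotient k))))
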